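{- Let $a,b,q$ be indeterminates and define $C_n^*(a,b,q)$ by $C_0^*(a,b,q)=1$ and, for $n\ge1$, $$C_n^*(a,b,q)=a\,C_{n-1}^*(a,b,q)+b\sum_{k=0}^{n-2}q^kC_k^*(a,b,q)\,C_{n-1-k}^*(a,b,q).$$ Then for every $n\ge0$, $$\det\big(C^*_{i+j}(a,b,q)\big)_{i,j=0}^{n}=(ab)^{\binom{n+1}{2}}q^{\frac{n(n+1)(n-1)}{3}}.$$ -}

module Defs where

open import Algebra.Bundles using (CommutativeRing)
open import Data.Nat using (ℕ; zero; suc; _∸_; _≤?_)
open import Data.Fin using (Fin; zero; suc; toℕ; punchIn)
open import Relation.Nullary using (yes; no)

module _ {c ℓ} (R : CommutativeRing c ℓ) where
  open CommutativeRing R using (Carrier; _+_; _*_; -_; 0#; 1#)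

  pow : Carrier → ℕ → Carrier
  pow x zero    = 1#
  pow x (suc k) = x * pow x k

  sumTo : ℕ → (ℕ → Carrier) → Carrier
  sumTo zero    f = 0#
  sumTo (suc n) f = sumTo n f + f n

  sumFin : (n : ℕ) → (Fin n → Carrier) → Carrier
  sumFin zero    f = 0#
  sumFin (suc n) f = f zero + sumFin n (λ i → f (suc i))

  det : (n : ℕ) → (Fin n → Fin n → Carrier) → Carrier
  det zero    M = 1#
  det (suc n) M =
    sumFin (suc n) (λ j →
      pow (- 1#) (toℕ j) * M zero j * det n (λ i k → M (suc i) (punchIn j k)))

  module _ (a b q : Carrier) where
    -- given f k = C*_k for k ≤ n, compute C*_{n+1}
    --   = a C*_n + b Σ_{k=0}^{n-1} q^k C*_k C*_{n-k}
    step : ℕ → (ℕ → Carrier) → Carrier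
    step n f = a * f n + b * sumTo n (λ k → pow q k * f k * f (n ∸ k))

    -- hist n k = C*_k(a,b,q) for all k ≤ n
    hist : ℕ → ℕ → Carrier
    hist zero    k = 1#
    hist (suc n) k with k ≤? n
    ... | yes _ = hist n k
    ... | no  _ = step n (hist n)

    Cstar : ℕ → Carrier
    Cstar n = hist n n

{-# OPTIONS --safe #-}
-- Let C(x) = Σ C*ₙ xⁿ and F(x) = C(qx). The recurrence reads C = 1 + x(aC + bF(C − 1)).
-- With h = 1/(1 − bxF) and g = Fh this becomes C = 1 + x(aC + ab·x·Cg) and
-- g = 1 + x((aq + b)g + abq²·x·g·g(qx)), so the series Pₖ = xᵏ C g(x) g(qx) ⋯ g(qᵏ⁻¹x) satisfy
-- Pₖ = [k = 0] + x(Pₖ₋₁ + sₖPₖ + λₖPₖ₊₁) with s₀ = a, sₖ = (aq + b)qᵏ⁻¹, λₖ = abq²ᵏ.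
-- Their coefficients L(n, k) form a Stieltjes table: L(n + 1, ·) is L(n, ·) under a Jacobi
-- operator that is self-adjoint for the weights μₖ = λ₀ ⋯ λₖ₋₁. Hence C*ᵢ₊ⱼ = Σₖ L(i, k) μₖ L(j, k):
-- the Hankel matrix is L·D·Lᵀ with L unitriangular, and its determinant is
-- ∏_{k ≤ n} μₖ = ∏_{k ≤ n} (ab)ᵏ q^{k(k−1)} = (ab)^{C(n+1,2)} q^{n(n+1)(n−1)/3}.
module Submission where

open import Defs
open import Algebra.Bundles using (CommutativeRing; Monoid)
open import Data.Nat as ℕ using (ℕ; zero; suc; z≤n; s≤s; _∸_; _/_)
import Data.Nat.Properties as ℕ
open import Data.Nat.Tactic.RingSolver using (solve-∀)
open import Data.Fin as Fin using (Fin; zero; suc; toℕ; inject₁; punchIn; punchOut; fromℕ<)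
open import Data.Fin.Properties
  using (toℕ-inject₁; toℕ-fromℕ; suc-injective; toℕ-injective; toℕ-fromℕ<; toℕ<n; punchInᵢ≢i; punchIn-injective; punchIn-punchOut; _≟_)
open import Data.Product using (∃-syntax; _×_; _,_)
open import Data.Empty using (⊥-elim)
open import Data.Sum using (inj₁; inj₂)
open import Function using (_∘_)
open import Level using (_⊔_)
open import Relation.Binary.Definitions using (tri<; tri≈; tri>)
open import Relation.Binary.PropositionalEquality as ≡ using (_≡_; _≢_; cong; cong₂)
open import Relation.Nullary using (yes; no)

punchIn-inject₁-self : ∀ {n} (i : Fin n) → punchIn (inject₁ i) i ≡ suc i
punchIn-inject₁-self zero    = ≡.refl
punchIn-inject₁-self (suc i) = cong suc (punchIn-inject₁-self i)

punchIn-suc-self : ∀ {n} (i : Fin n) → punchIn (suc i) i ≡ inject₁ i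
punchIn-suc-self zero    = ≡.refl
punchIn-suc-self (suc i) = cong suc (punchIn-suc-self i)

punchIn-inject₁≡punchIn-suc : ∀ {n} (i k : Fin n) → k ≢ i → punchIn (inject₁ i) k ≡ punchIn (suc i) k
punchIn-inject₁≡punchIn-suc zero    zero    k≢i = ⊥-elim (k≢i ≡.refl)
punchIn-inject₁≡punchIn-suc zero    (suc k) _   = ≡.refl
punchIn-inject₁≡punchIn-suc (suc i) zero    _   = ≡.refl
punchIn-inject₁≡punchIn-suc (suc i) (suc k) k≢i = cong suc (punchIn-inject₁≡punchIn-suc i k (k≢i ∘ cong suc))

inject₁≢suc : ∀ {n} (i : Fin n) → inject₁ i ≢ suc i
inject₁≢suc zero    ()
inject₁≢suc (suc i) eq = inject₁≢suc i (suc-injective eq)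

punchIn-adjacent : ∀ {n} (c : Fin (suc (suc n))) (i : Fin (suc n)) → c ≢ inject₁ i → c ≢ suc i →
  ∃[ i′ ] punchIn c (inject₁ i′) ≡ inject₁ i × punchIn c (suc i′) ≡ suc i
punchIn-adjacent zero          zero    c≢i _  = ⊥-elim (c≢i ≡.refl)
punchIn-adjacent zero          (suc i) _   _  = i , ≡.refl , ≡.refl
punchIn-adjacent (suc zero)    zero    _  c≢i = ⊥-elim (c≢i ≡.refl)
punchIn-adjacent {suc n} (suc (suc c)) zero _ _ = zero , ≡.refl , ≡.refl
punchIn-adjacent {suc n} (suc c) (suc i) c≢i c≢i′
  with i′ , p , q ← punchIn-adjacent c i (c≢i ∘ cong suc) (c≢i′ ∘ cong suc)
  = suc i′ , cong suc p , cong suc q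

Stable : ∀ {a} {A : Set a} → (ℕ → ℕ → A) → Set a
Stable H = ∀ n k → k ℕ.≤ n → H (suc n) k ≡ H n k

stable⇒diagonal : ∀ {a} {A : Set a} {H : ℕ → ℕ → A} → Stable H → ∀ n k → k ℕ.≤ n → H n k ≡ H k k
stable⇒diagonal stable zero    zero z≤n = ≡.refl
stable⇒diagonal stable (suc n) k  k≤1+n with ℕ.m≤n⇒m<n∨m≡n k≤1+n
... | inj₁ k<1+n  = ≡.trans (stable n k (ℕ.s≤s⁻¹ k<1+n)) (stable⇒diagonal stable n k (ℕ.s≤s⁻¹ k<1+n))
... | inj₂ ≡.refl = ≡.refl

module _ {c ℓ} (M : Monoid c ℓ) where

  open Monoid M
  open import Algebra.Properties.Monoid.Sum M using (sum; sum-init-last; sum-cong-≋; sum-cong-≗; sum-replicate-zero)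

  sum-zero : ∀ {N} (f : Fin N → Carrier) → (∀ i → f i ≈ ε) → sum f ≈ ε
  sum-zero {N} f f≈ε = trans (sum-cong-≋ f≈ε) (sum-replicate-zero N)

  sum-toℕ-last : ∀ N (φ : ℕ → Carrier) → sum {suc N} (φ ∘ toℕ) ≈ sum {N} (φ ∘ toℕ) ∙ φ N
  sum-toℕ-last N φ = trans (sum-init-last (φ ∘ toℕ))
    (reflexive (cong₂ _∙_ (sum-cong-≗ {N} {φ ∘ toℕ ∘ inject₁} (cong φ ∘ toℕ-inject₁)) (cong φ (toℕ-fromℕ N))))

-- det expands along the first row, so its invariances are proved for column operations.
module Determinant {c ℓ} (R : CommutativeRing c ℓ) where

  open CommutativeRing R hiding (zero)
  open import Algebra.Properties.Ring ring using (-1*x≈-x; -0#≈0#; +-inverseˡ-unique)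
  open import Algebra.Properties.CommutativeMonoid.Sum +-commutativeMonoid
    using (sum; sum-cong-≋; sum-remove; ∑-distrib-+)
  open import Algebra.Properties.Semiring.Sum semiring using (*-distribˡ-sum)
  open import Algebra.Properties.Monoid.Sum *-monoid using () renaming (sum to product)
  open import Data.Vec.Functional using (updateAt)
  open import Data.Vec.Functional.Properties using (updateAt-updates; updateAt-minimal)
  open import Algebra.Solver.Ring.NaturalCoefficients.Default commutativeSemiring
  open import Relation.Binary.Reasoning.Setoid setoid

  private variable n : ℕ

  sumFin≡sum : ∀ n (f : Fin n → Carrier) → sumFin R n f ≡ sum f
  sumFin≡sum zero    f = ≡.refl
  sumFin≡sum (suc n) f = cong (f zero +_) (sumFin≡sum n (f ∘ suc))

  Matrix : ℕ → Set c
  Matrix n = Fin n → Fin n → Carrier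

  minor : Fin (suc n) → Matrix (suc n) → Matrix n
  minor j M i k = M (suc i) (punchIn j k)

  sign : Fin n → Carrier
  sign j = pow R (- 1#) (toℕ j)

  laplaceTerm : Matrix (suc n) → Fin (suc n) → Carrier
  laplaceTerm M j = sign j * M zero j * det R _ (minor j M)

  det-laplace : (M : Matrix (suc n)) → det R (suc n) M ≡ sum (laplaceTerm M)
  det-laplace M = sumFin≡sum _ (laplaceTerm M)

  det-cong : {M N : Matrix n} → (∀ i k → M i k ≈ N i k) → det R n M ≈ det R n N
  det-cong {zero}  _   = refl
  det-cong {suc n} {M} {N} M≈N = begin
    det R (suc n) M        ≡⟨ det-laplace M ⟩
    sum (laplaceTerm M)    ≈⟨ sum-cong-≋ {x = laplaceTerm M} {laplaceTerm N} (λ j → *-cong (*-congˡ (M≈N zero j)) (det-cong (λ i k → M≈N (suc i) (punchIn j k)))) ⟩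
    sum (laplaceTerm N)    ≡⟨ det-laplace N ⟨
    det R (suc n) N        ∎

  setColumn : Fin n → (Fin n → Carrier) → Matrix n → Matrix n
  setColumn j v M i = updateAt (M i) j (λ _ → v i)

  setColumn-on : ∀ j v (M : Matrix n) i → setColumn j v M i j ≡ v i
  setColumn-on j v M i = updateAt-updates j (M i)

  setColumn-off : ∀ {j k} v (M : Matrix n) i → k ≢ j → setColumn j v M i k ≡ M i k
  setColumn-off {j = j} {k} v M i = updateAt-minimal k j (M i)

  setColumn-cong : ∀ j {v w} {M N : Matrix n} → (∀ i → v i ≈ w i) → (∀ i k → k ≢ j → M i k ≈ N i k) →
    ∀ i k → setColumn j v M i k ≈ setColumn j w N i k
  setColumn-cong j {v} {w} {M} {N} v≈w M≈N i k with k ≟ j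
  ... | yes ≡.refl = trans (reflexive (setColumn-on k v M i)) (trans (v≈w i) (reflexive (≡.sym (setColumn-on k w N i))))
  ... | no k≢j   = trans (reflexive (setColumn-off v M i k≢j)) (trans (M≈N i k k≢j) (reflexive (≡.sym (setColumn-off w N i k≢j))))

  setColumn-self : ∀ j (M : Matrix n) i k → setColumn j (λ r → M r j) M i k ≈ M i k
  setColumn-self j M i k with k ≟ j
  ... | yes ≡.refl = reflexive (setColumn-on k (λ r → M r k) M i)
  ... | no k≢j   = reflexive (setColumn-off (λ r → M r j) M i k≢j)

  setColumn-comm : ∀ {j j′} → j ≢ j′ → ∀ v v′ (M : Matrix n) i k →
    setColumn j v (setColumn j′ v′ M) i k ≈ setColumn j′ v′ (setColumn j v M) i k
  setColumn-comm {j = j} {j′} j≢j′ v v′ M i k with k ≟ j | k ≟ j′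
  ... | yes ≡.refl | yes ≡.refl = ⊥-elim (j≢j′ ≡.refl)
  ... | yes ≡.refl | no k≢j′  = reflexive (≡.trans (setColumn-on k v (setColumn j′ v′ M) i)
                                   (≡.sym (≡.trans (setColumn-off v′ (setColumn k v M) i k≢j′) (setColumn-on k v M i))))
  ... | no k≢j   | yes ≡.refl = reflexive (≡.trans (setColumn-off v (setColumn k v′ M) i k≢j)
                                   (≡.trans (setColumn-on k v′ M i) (≡.sym (setColumn-on k v′ (setColumn j v M) i))))
  ... | no k≢j   | no k≢j′  = reflexive (≡.trans (setColumn-off v (setColumn j′ v′ M) i k≢j) (≡.trans (setColumn-off v′ M i k≢j′)
                                 (≡.sym (≡.trans (setColumn-off v′ (setColumn j v M) i k≢j′) (setColumn-off v M i k≢j)))))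

  minor-setColumn-self : ∀ j v (M : Matrix (suc n)) i k → minor j (setColumn j v M) i k ≡ minor j M i k
  minor-setColumn-self j v M i k = setColumn-off v M (suc i) (punchInᵢ≢i j k)

  minor-setColumn : ∀ {c j} (c≢j : c ≢ j) v (M : Matrix (suc n)) i k →
    minor c (setColumn j v M) i k ≡ setColumn (punchOut c≢j) (v ∘ suc) (minor c M) i k
  minor-setColumn {c = c} {j} c≢j v M i k with k ≟ punchOut c≢j
  ... | yes ≡.refl = ≡.trans (cong (setColumn j v M (suc i)) (punchIn-punchOut c≢j))
                     (≡.trans (setColumn-on j v M (suc i)) (≡.sym (setColumn-on k (v ∘ suc) (minor c M) i)))
  ... | no k≢p   = ≡.trans (setColumn-off v M (suc i) cₖ≢j) (≡.sym (setColumn-off (v ∘ suc) (minor c M) i k≢p))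
    where
    cₖ≢j : punchIn c k ≢ j
    cₖ≢j eq = k≢p (punchIn-injective c k _ (≡.trans eq (≡.sym (punchIn-punchOut c≢j))))

  det-linearCombination : ∀ α β (N A B : Matrix (suc n)) →
    (∀ c → laplaceTerm N c ≈ α * laplaceTerm A c + β * laplaceTerm B c) → det R (suc n) N ≈ α * det R (suc n) A + β * det R (suc n) B
  det-linearCombination α β N A B terms = begin
    det R _ N                                           ≡⟨ det-laplace N ⟩
    sum (laplaceTerm N)                                 ≈⟨ sum-cong-≋ {x = laplaceTerm N} terms ⟩
    sum (λ c → α * laplaceTerm A c + β * laplaceTerm B c)
      ≈⟨ ∑-distrib-+ (λ c → α * laplaceTerm A c) (λ c → β * laplaceTerm B c) ⟩
    sum (λ c → α * laplaceTerm A c) + sum (λ c → β * laplaceTerm B c)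
      ≈⟨ +-cong (*-distribˡ-sum α (laplaceTerm A)) (*-distribˡ-sum β (laplaceTerm B)) ⟨
    α * sum (laplaceTerm A) + β * sum (laplaceTerm B)   ≡⟨ cong₂ (λ x y → α * x + β * y) (det-laplace A) (det-laplace B) ⟨
    α * det R _ A + β * det R _ B                       ∎

  laplaceTerm-setColumn-self : ∀ j α β {u v w : Fin (suc n) → Carrier} (M : Matrix (suc n)) → w zero ≈ α * u zero + β * v zero →
    laplaceTerm (setColumn j w M) j ≈ α * laplaceTerm (setColumn j u M) j + β * laplaceTerm (setColumn j v M) j
  laplaceTerm-setColumn-self {n} j α β {u} {v} {w} M w₀≈ = begin
    sign j * setColumn j w M zero j * det R n (minor j (setColumn j w M))
      ≈⟨ *-cong (*-congˡ (trans (reflexive (setColumn-on j w M zero)) w₀≈)) (det-minor≈D w) ⟩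
    sign j * (α * u zero + β * v zero) * D
      ≈⟨ solve 6 (λ s α β x y d → s :* (α :* x :+ β :* y) :* d := α :* (s :* x :* d) :+ β :* (s :* y :* d))
               refl (sign j) α β (u zero) (v zero) D ⟩
    α * (sign j * u zero * D) + β * (sign j * v zero * D)
      ≈⟨ +-cong (*-congˡ (*-cong (*-congˡ (reflexive (≡.sym (setColumn-on j u M zero)))) (sym (det-minor≈D u))))
                (*-congˡ (*-cong (*-congˡ (reflexive (≡.sym (setColumn-on j v M zero)))) (sym (det-minor≈D v)))) ⟩
    α * laplaceTerm (setColumn j u M) j + β * laplaceTerm (setColumn j v M) j ∎
    where
    D = det R n (minor j M)
    det-minor≈D : ∀ x → det R n (minor j (setColumn j x M)) ≈ D
    det-minor≈D x = det-cong (λ i k → reflexive (minor-setColumn-self j x M i k))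

  det-linear : ∀ j α β {u v w : Fin n → Carrier} (M : Matrix n) → (∀ i → w i ≈ α * u i + β * v i) →
    det R n (setColumn j w M) ≈ α * det R n (setColumn j u M) + β * det R n (setColumn j v M)
  det-linear {suc n} j α β {u} {v} {w} M w≈ = det-linearCombination α β (setColumn j w M) (setColumn j u M) (setColumn j v M) term-linear
    where
    term-linear : ∀ c → laplaceTerm (setColumn j w M) c ≈ α * laplaceTerm (setColumn j u M) c + β * laplaceTerm (setColumn j v M) c
    term-linear c with c ≟ j
    ... | yes ≡.refl = laplaceTerm-setColumn-self c α β {u} {v} {w} M (w≈ zero)
    ... | no c≢j = begin
      x w * det R n (minor c (setColumn j w M))
        ≈⟨ *-congˡ (trans (det-minor w) (det-linear p α β (minor c M) (w≈ ∘ suc))) ⟩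
      x w * (α * det R n (setColumn p (u ∘ suc) (minor c M)) + β * det R n (setColumn p (v ∘ suc) (minor c M)))
        ≈⟨ *-congˡ (+-cong (*-congˡ (sym (det-minor u))) (*-congˡ (sym (det-minor v)))) ⟩
      x w * (α * Dᵤ + β * Dᵥ)
        ≈⟨ solve 5 (λ x α β d e → x :* (α :* d :+ β :* e) := α :* (x :* d) :+ β :* (x :* e)) refl (x w) α β Dᵤ Dᵥ ⟩
      α * (x w * Dᵤ) + β * (x w * Dᵥ)
        ≈⟨ +-cong (*-congˡ (*-congʳ (x-off u))) (*-congˡ (*-congʳ (x-off v))) ⟩
      α * laplaceTerm (setColumn j u M) c + β * laplaceTerm (setColumn j v M) c ∎
      where
      p = punchOut c≢j
      x : (Fin (suc n) → Carrier) → Carrier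
      x y = sign c * setColumn j y M zero c
      x-off : ∀ y → x w ≈ x y
      x-off y = *-congˡ (reflexive (≡.trans (setColumn-off w M zero c≢j) (≡.sym (setColumn-off y M zero c≢j))))
      Dᵤ = det R n (minor c (setColumn j u M))
      Dᵥ = det R n (minor c (setColumn j v M))
      det-minor : ∀ y → det R n (minor c (setColumn j y M)) ≈ det R n (setColumn p (y ∘ suc) (minor c M))
      det-minor y = det-cong (λ i k → reflexive (minor-setColumn c≢j y M i k))

  minor-adjacent : (M : Matrix (suc (suc n))) (i : Fin (suc n)) → (∀ r → M r (inject₁ i) ≈ M r (suc i)) →
    ∀ r k → minor (inject₁ i) M r k ≈ minor (suc i) M r k
  minor-adjacent M i cols≈ r k with k ≟ i
  ... | yes ≡.refl = begin
    M (suc r) (punchIn (inject₁ k) k) ≡⟨ cong (M (suc r)) (punchIn-inject₁-self k) ⟩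
    M (suc r) (suc k)                 ≈⟨ cols≈ (suc r) ⟨
    M (suc r) (inject₁ k)             ≡⟨ cong (M (suc r)) (punchIn-suc-self k) ⟨
    M (suc r) (punchIn (suc k) k)     ∎
  ... | no k≢i = reflexive (cong (M (suc r)) (punchIn-inject₁≡punchIn-suc i k k≢i))

  sign-suc : (i : Fin n) → sign (suc i) ≈ - 1# * sign (inject₁ i)
  sign-suc i = reflexive (cong (λ e → - 1# * pow R (- 1#) e) (≡.sym (toℕ-inject₁ i)))

  det-adjacentEqual : (M : Matrix (suc n)) (i : Fin n) → (∀ r → M r (inject₁ i) ≈ M r (suc i)) → det R (suc n) M ≈ 0#
  det-adjacentEqual {suc n} M i cols≈ = begin
    det R (suc (suc n)) M                 ≡⟨ det-laplace M ⟩
    sum t                                 ≈⟨ sum-remove {i = inject₁ i} t ⟩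
    t (inject₁ i) + sum (t ∘ punchIn (inject₁ i))
      ≈⟨ +-congˡ (sum-remove {i = i} (t ∘ punchIn (inject₁ i))) ⟩
    t (inject₁ i) + (t (punchIn (inject₁ i) i) + sum (t ∘ punchIn (inject₁ i) ∘ punchIn i))
      ≈⟨ +-congˡ (+-cong (reflexive (cong t (punchIn-inject₁-self i))) (sum-zero +-monoid _ (λ k → others (punchInᵢ≢i (inject₁ i) (punchIn i k)) (≢suc k)))) ⟩
    t (inject₁ i) + (t (suc i) + 0#)       ≈⟨ +-congˡ (+-identityʳ _) ⟩
    t (inject₁ i) + t (suc i)              ≈⟨ +-congˡ (*-cong (*-cong (sign-suc i) (sym (cols≈ zero))) (sym (det-cong (minor-adjacent M i cols≈)))) ⟩
    s * x * d + - 1# * s * x * d           ≈⟨ +-congˡ (solve 4 (λ m s x d → m :* s :* x :* d := m :* (s :* x :* d)) refl (- 1#) s x d) ⟩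
    s * x * d + - 1# * (s * x * d)         ≈⟨ +-congˡ (-1*x≈-x _) ⟩
    s * x * d + - (s * x * d)              ≈⟨ -‿inverseʳ _ ⟩
    0#                                     ∎
    where
    t = laplaceTerm M
    s = sign (inject₁ i)
    x = M zero (inject₁ i)
    d = det R (suc n) (minor (inject₁ i) M)
    ≢suc : ∀ k → punchIn (inject₁ i) (punchIn i k) ≢ suc i
    ≢suc k eq = punchInᵢ≢i i k (punchIn-injective (inject₁ i) _ i (≡.trans eq (≡.sym (punchIn-inject₁-self i))))
    others : ∀ {c} → c ≢ inject₁ i → c ≢ suc i → t c ≈ 0#
    others {c} c≢i c≢i′ with i′ , p , q ← punchIn-adjacent c i c≢i c≢i′ =
      trans (*-congˡ (det-adjacentEqual (minor c M) i′ (λ r → trans (reflexive (cong (M (suc r)) p)) (trans (cols≈ (suc r)) (reflexive (cong (M (suc r)) (≡.sym q)))))))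
            (zeroʳ _)

  det-swapAdjacent : (M : Matrix (suc n)) (i : Fin n) (u v : Fin (suc n) → Carrier) →
    det R (suc n) (setColumn (inject₁ i) u (setColumn (suc i) v M)) ≈ - det R (suc n) (setColumn (inject₁ i) v (setColumn (suc i) u M))
  det-swapAdjacent {n} M i u v = +-inverseˡ-unique (D u v) (D v u) (begin
    D u v + D v u                            ≈⟨ +-cong (+-identityˡ _) (+-identityʳ _) ⟨
    (0# + D u v) + (D v u + 0#)              ≈⟨ +-cong (+-congʳ (D-same u)) (+-congˡ (D-same v)) ⟨
    (D u u + D u v) + (D v u + D v v)        ≈⟨ +-cong (D-additiveʳ u u v) (D-additiveʳ v u v) ⟨
    D u (u ⊕ v) + D v (u ⊕ v)                ≈⟨ D-additiveˡ u v (u ⊕ v) ⟨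
    D (u ⊕ v) (u ⊕ v)                        ≈⟨ D-same (u ⊕ v) ⟩
    0#                                       ∎)
    where
    W : (Fin (suc n) → Carrier) → (Fin (suc n) → Carrier) → Matrix (suc n)
    W x y = setColumn (inject₁ i) x (setColumn (suc i) y M)
    D : (Fin (suc n) → Carrier) → (Fin (suc n) → Carrier) → Carrier
    D x y = det R (suc n) (W x y)
    _⊕_ : (Fin (suc n) → Carrier) → (Fin (suc n) → Carrier) → Fin (suc n) → Carrier
    (x ⊕ y) r = x r + y r
    sum≈1*+1* : ∀ x y r → (x ⊕ y) r ≈ 1# * x r + 1# * y r
    sum≈1*+1* x y r = sym (+-cong (*-identityˡ _) (*-identityˡ _))
    D-additiveˡ : ∀ x x′ y → D (x ⊕ x′) y ≈ D x y + D x′ y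
    D-additiveˡ x x′ y = trans (det-linear (inject₁ i) 1# 1# (setColumn (suc i) y M) (sum≈1*+1* x x′)) (+-cong (*-identityˡ _) (*-identityˡ _))
    D-additiveʳ : ∀ x y y′ → D x (y ⊕ y′) ≈ D x y + D x y′
    D-additiveʳ x y y′ = begin
      D x (y ⊕ y′)                                        ≈⟨ det-cong (setColumn-comm (inject₁≢suc i) x (y ⊕ y′) M) ⟩
      det R (suc n) (setColumn (suc i) (y ⊕ y′) (setColumn (inject₁ i) x M))
        ≈⟨ det-linear (suc i) 1# 1# (setColumn (inject₁ i) x M) (sum≈1*+1* y y′) ⟩
      1# * det R (suc n) (setColumn (suc i) y (setColumn (inject₁ i) x M)) + 1# * det R (suc n) (setColumn (suc i) y′ (setColumn (inject₁ i) x M))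
        ≈⟨ +-cong (trans (*-identityˡ _) (sym (det-cong (setColumn-comm (inject₁≢suc i) x y M))))
                  (trans (*-identityˡ _) (sym (det-cong (setColumn-comm (inject₁≢suc i) x y′ M)))) ⟩
      D x y + D x y′                                      ∎
    D-same : ∀ x → D x x ≈ 0#
    D-same x = det-adjacentEqual (W x x) i (λ r → reflexive (≡.trans (setColumn-on (inject₁ i) x (setColumn (suc i) x M) r)
      (≡.sym (≡.trans (setColumn-off x (setColumn (suc i) x M) r (inject₁≢suc i ∘ ≡.sym)) (setColumn-on (suc i) x M r)))))

  -- An adjacent swap moves column j′ = suc i one step closer to j.
  det-equalColumns< : ∀ m (M : Matrix n) {j j′} → toℕ j′ ≡ m → toℕ j ℕ.< m → (∀ r → M r j ≈ M r j′) → det R n M ≈ 0#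
  det-equalColumns< (suc m) M {j} {suc i} j′≡ j<m cols≈ with ℕ.m<1+n⇒m<n∨m≡n j<m
  ... | inj₂ j≡m = det-adjacentEqual M i (λ r → trans (reflexive (cong (M r) (≡.sym j≡i))) (cols≈ r))
    where
    j≡i : j ≡ inject₁ i
    j≡i = toℕ-injective (≡.trans j≡m (≡.trans (≡.sym (ℕ.suc-injective j′≡)) (≡.sym (toℕ-inject₁ i))))
  ... | inj₁ j<m′ = begin
    det R _ M                   ≈⟨ det-cong M≈W ⟨
    det R _ (W (col (inject₁ i)) (col (suc i)))  ≈⟨ det-swapAdjacent M i (col (inject₁ i)) (col (suc i)) ⟩
    - det R _ M′                ≈⟨ -‿cong (det-equalColumns< m M′ {j} {inject₁ i} i≡m j<m′ M′-cols) ⟩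
    - 0#                        ≈⟨ -0#≈0# ⟩
    0#                          ∎
    where
    col : Fin _ → Fin _ → Carrier
    col k r = M r k
    W : (Fin _ → Carrier) → (Fin _ → Carrier) → Matrix _
    W x y = setColumn (inject₁ i) x (setColumn (suc i) y M)
    M′ = W (col (suc i)) (col (inject₁ i))
    i≡m : toℕ (inject₁ i) ≡ m
    i≡m = ≡.trans (toℕ-inject₁ i) (ℕ.suc-injective j′≡)
    M≈W : ∀ r k → W (col (inject₁ i)) (col (suc i)) r k ≈ M r k
    M≈W r k = trans (setColumn-cong (inject₁ i) {col (inject₁ i)} {col (inject₁ i)} {setColumn (suc i) (col (suc i)) M} (λ _ → refl) (λ r k _ → setColumn-self (suc i) M r k) r k) (setColumn-self (inject₁ i) M r k)
    j≢i : j ≢ inject₁ i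
    j≢i eq = ℕ.<⇒≢ j<m′ (≡.trans (cong toℕ eq) i≡m)
    j≢suc-i : j ≢ suc i
    j≢suc-i eq = ℕ.<⇒≢ j<m (≡.trans (cong toℕ eq) j′≡)
    M′-cols : ∀ r → M′ r j ≈ M′ r (inject₁ i)
    M′-cols r = begin
      M′ r j               ≡⟨ ≡.trans (setColumn-off (col (suc i)) (setColumn (suc i) (col (inject₁ i)) M) r j≢i) (setColumn-off (col (inject₁ i)) M r j≢suc-i) ⟩
      M r j                ≈⟨ cols≈ r ⟩
      M r (suc i)          ≡⟨ setColumn-on (inject₁ i) (col (suc i)) (setColumn (suc i) (col (inject₁ i)) M) r ⟨
      M′ r (inject₁ i)     ∎

  det-equalColumns : (M : Matrix n) {j j′ : Fin n} → j ≢ j′ → (∀ r → M r j ≈ M r j′) → det R n M ≈ 0#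
  det-equalColumns M {j} {j′} j≢j′ cols≈ with ℕ.<-cmp (toℕ j) (toℕ j′)
  ... | tri< j<j′ _ _ = det-equalColumns< (toℕ j′) M ≡.refl j<j′ cols≈
  ... | tri≈ _ j≡j′ _ = ⊥-elim (j≢j′ (toℕ-injective j≡j′))
  ... | tri> _ _ j′<j = det-equalColumns< (toℕ j) M ≡.refl j′<j (λ r → sym (cols≈ r))

  det-sumColumn : ∀ {m} j (a : Fin m → Carrier) (v : Fin m → Fin n → Carrier) (M : Matrix n) {w : Fin n → Carrier} →
    (∀ i → w i ≈ sum (λ t → a t * v t i)) → det R n (setColumn j w M) ≈ sum (λ t → a t * det R n (setColumn j (v t) M))
  det-sumColumn {n} {zero} j a v M {w} w≈ = begin
    det R n (setColumn j w M)                                ≈⟨ det-linear j 0# 0# M w≈0*w+0*w ⟩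
    0# * det R n (setColumn j w M) + 0# * det R n (setColumn j w M) ≈⟨ +-cong (zeroˡ _) (zeroˡ _) ⟩
    0# + 0#                                                  ≈⟨ +-identityˡ 0# ⟩
    0#                                                       ∎
    where
    w≈0*w+0*w : ∀ i → w i ≈ 0# * w i + 0# * w i
    w≈0*w+0*w i = trans (w≈ i) (sym (trans (+-cong (zeroˡ _) (zeroˡ _)) (+-identityˡ 0#)))
  det-sumColumn {n} {suc m} j a v M {w} w≈ = begin
    det R n (setColumn j w M)
      ≈⟨ det-linear j (a zero) 1# M (λ i → trans (w≈ i) (+-congˡ (sym (*-identityˡ _)))) ⟩
    a zero * det R n (setColumn j (v zero) M) + 1# * det R n (setColumn j rest M)
      ≈⟨ +-congˡ (trans (*-identityˡ _) (det-sumColumn j (a ∘ suc) (v ∘ suc) M (λ _ → refl))) ⟩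
    sum (λ t → a t * det R n (setColumn j (v t) M))           ∎
    where
    rest : Fin n → Carrier
    rest i = sum (λ t → a (suc t) * v (suc t) i)

  det-addColumns : ∀ j (a : Fin n → Carrier) (M : Matrix n) {w : Fin n → Carrier} → a j ≈ 1# →
    (∀ i → w i ≈ sum (λ k → a k * M i k)) → det R n (setColumn j w M) ≈ det R n M
  det-addColumns {suc n} j a M {w} aⱼ≈1 w≈ = begin
    det R (suc n) (setColumn j w M)             ≈⟨ det-sumColumn j a col M w≈ ⟩
    sum (λ k → a k * D k)                       ≈⟨ sum-remove {i = j} (λ k → a k * D k) ⟩
    a j * D j + sum (λ k → a (punchIn j k) * D (punchIn j k))
      ≈⟨ +-cong (*-cong aⱼ≈1 (det-cong (setColumn-self j M))) (sum-zero +-monoid _ (λ k → trans (*-congˡ (D-other k)) (zeroʳ _))) ⟩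
    1# * det R (suc n) M + 0#                   ≈⟨ trans (+-identityʳ _) (*-identityˡ _) ⟩
    det R (suc n) M                             ∎
    where
    col : Fin (suc n) → Fin (suc n) → Carrier
    col k i = M i k
    D : Fin (suc n) → Carrier
    D k = det R (suc n) (setColumn j (col k) M)
    D-other : ∀ k → D (punchIn j k) ≈ 0#
    D-other k = det-equalColumns (setColumn j (col (punchIn j k)) M) (punchInᵢ≢i j k ∘ ≡.sym) (λ r →
      reflexive (≡.trans (setColumn-on j (col (punchIn j k)) M r) (≡.sym (setColumn-off (col (punchIn j k)) M r (punchInᵢ≢i j k)))))

  infixl 7 _*ᴹ_
  _*ᴹ_ : Matrix n → Matrix n → Matrix n
  (M *ᴹ N) i j = sum (λ k → M i k * N k j)

  spliceColumns : ℕ → Matrix n → Matrix n → Matrix n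
  spliceColumns t M N i k with t ℕ.≤? toℕ k
  ... | yes _ = N i k
  ... | no _  = M i k

  -- Column t of M *ᴹ U is column t of M plus multiples of the columns k < t of M,
  -- and those are still columns of the spliced matrix.
  det-spliceColumns-step : (M U : Matrix n) → (∀ k j → j Fin.< k → U k j ≈ 0#) → (∀ j → U j j ≈ 1#) →
    ∀ t (t<n : t ℕ.< n) → det R n (spliceColumns t M (M *ᴹ U)) ≈ det R n (spliceColumns (suc t) M (M *ᴹ U))
  det-spliceColumns-step {n} M U U-upper U-diag t t<n =
    trans (det-cong Sₜ≈) (det-addColumns jₜ (λ k → U k jₜ) Sₜ₊₁ (U-diag jₜ) (λ _ → refl))
    where
    jₜ = fromℕ< t<n
    Sₜ Sₜ₊₁ : Matrix n
    Sₜ = spliceColumns t M (M *ᴹ U)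
    Sₜ₊₁ = spliceColumns (suc t) M (M *ᴹ U)
    w : Fin n → Carrier
    w r = sum (λ k → U k jₜ * Sₜ₊₁ r k)
    column-t : ∀ i → Sₜ i jₜ ≈ w i
    column-t i with t ℕ.≤? toℕ jₜ
    ... | no t≰t = ⊥-elim (t≰t (ℕ.≤-reflexive (≡.sym (toℕ-fromℕ< t<n))))
    ... | yes _  = sum-cong-≋ {x = λ k → M i k * U k jₜ} term
      where
      term : ∀ k → M i k * U k jₜ ≈ U k jₜ * Sₜ₊₁ i k
      term k with suc t ℕ.≤? toℕ k
      ... | yes t<k = trans (*-congˡ U≈0) (trans (zeroʳ _) (sym (trans (*-congʳ U≈0) (zeroˡ _))))
        where
        U≈0 : U k jₜ ≈ 0#
        U≈0 = U-upper k jₜ (≡.subst (ℕ._< toℕ k) (≡.sym (toℕ-fromℕ< t<n)) t<k)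
      ... | no _    = *-comm _ _
    other-columns : ∀ i {k} → k ≢ jₜ → Sₜ i k ≈ Sₜ₊₁ i k
    other-columns i {k} k≢jₜ with t ℕ.≤? toℕ k | suc t ℕ.≤? toℕ k
    ... | yes _   | yes _   = refl
    ... | no _    | no _    = refl
    ... | no t≰k  | yes t<k = ⊥-elim (t≰k (ℕ.<⇒≤ t<k))
    ... | yes t≤k | no t≮k  = ⊥-elim (k≢jₜ (toℕ-injective (≡.trans (ℕ.≤-antisym (ℕ.≮⇒≥ t≮k) t≤k) (≡.sym (toℕ-fromℕ< t<n)))))
    Sₜ≈ : ∀ i k → Sₜ i k ≈ setColumn jₜ w Sₜ₊₁ i k
    Sₜ≈ i k with k ≟ jₜ
    ... | yes ≡.refl = trans (column-t i) (reflexive (≡.sym (setColumn-on k w Sₜ₊₁ i)))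
    ... | no k≢jₜ    = trans (other-columns i k≢jₜ) (reflexive (≡.sym (setColumn-off w Sₜ₊₁ i k≢jₜ)))

  det-*ᴹ-unitriangular : (M U : Matrix n) → (∀ k j → j Fin.< k → U k j ≈ 0#) → (∀ j → U j j ≈ 1#) →
    det R n (M *ᴹ U) ≈ det R n M
  det-*ᴹ-unitriangular {n} M U U-upper U-diag = det-splice n (ℕ.+-identityʳ n)
    where
    det-splice : ∀ d {t} → d ℕ.+ t ≡ n → det R n (spliceColumns t M (M *ᴹ U)) ≈ det R n M
    det-splice zero    ≡.refl = det-cong spliced-n
      where
      spliced-n : ∀ i k → spliceColumns n M (M *ᴹ U) i k ≈ M i k
      spliced-n i k with n ℕ.≤? toℕ k
      ... | yes n≤k = ⊥-elim (ℕ.<⇒≱ (toℕ<n k) n≤k)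
      ... | no _    = refl
    det-splice (suc d) {t} d+t≡n =
      trans (det-spliceColumns-step M U U-upper U-diag t t<n) (det-splice d (≡.trans (ℕ.+-suc d t) d+t≡n))
      where
      t<n : t ℕ.< n
      t<n = ≡.subst (t ℕ.<_) d+t≡n (ℕ.m<n+m t (s≤s z≤n))

  det-lowerTriangular : (M : Matrix n) → (∀ i j → i Fin.< j → M i j ≈ 0#) → det R n M ≈ product (λ i → M i i)
  det-lowerTriangular {zero}  M lower = refl
  det-lowerTriangular {suc n} M lower = begin
    det R (suc n) M                                ≡⟨ det-laplace M ⟩
    laplaceTerm M zero + sum (laplaceTerm M ∘ suc)
      ≈⟨ +-cong (*-cong (*-identityˡ _) (det-lowerTriangular (minor zero M) (λ i j i<j → lower (suc i) (suc j) (s≤s i<j))))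
                (sum-zero +-monoid _ (λ k → trans (*-congʳ (trans (*-congˡ (lower zero (suc k) (s≤s z≤n))) (zeroʳ _))) (zeroˡ _))) ⟩
    M zero zero * product (λ i → M (suc i) (suc i)) + 0# ≈⟨ +-identityʳ _ ⟩
    product (λ i → M i i)                          ∎

module PowerSeries {c ℓ} (R : CommutativeRing c ℓ) where

  open CommutativeRing R hiding (zero)
  open import Relation.Binary.Reasoning.Setoid setoid
  open import Algebra.Solver.Ring.NaturalCoefficients.Default commutativeSemiring

  Series : Set c
  Series = ℕ → Carrier

  infix  4 _≋_
  infixl 6 _⊕_
  infixl 7 _⊛_

  _≋_ : Series → Series → Set ℓ
  f ≋ g = ∀ n → f n ≈ g n

  _⊕_ : Series → Series → Series
  (f ⊕ g) n = f n + g n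

  ⊖_ : Series → Series
  (⊖ f) n = - f n

  const : Carrier → Series
  const a zero    = a
  const a (suc n) = 0#

  X : Series
  X zero          = 0#
  X (suc zero)    = 1#
  X (suc (suc n)) = 0#

  _⊛_ : Series → Series → Series
  (f ⊛ g) zero    = f 0 * g 0
  (f ⊛ g) (suc n) = f 0 * g (suc n) + ((f ∘ suc) ⊛ g) n

  ⊛-cong : ∀ {f f′ g g′} → f ≋ f′ → g ≋ g′ → f ⊛ g ≋ f′ ⊛ g′
  ⊛-cong f≋f′ g≋g′ zero    = *-cong (f≋f′ 0) (g≋g′ 0)
  ⊛-cong f≋f′ g≋g′ (suc n) = +-cong (*-cong (f≋f′ 0) (g≋g′ (suc n))) (⊛-cong (f≋f′ ∘ suc) g≋g′ n)

  ⊛-local : ∀ n f {g g′} → (∀ k → k ℕ.≤ n → g k ≈ g′ k) → (f ⊛ g) n ≈ (f ⊛ g′) n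
  ⊛-local zero    f g≈g′ = *-congˡ (g≈g′ 0 z≤n)
  ⊛-local (suc n) f g≈g′ = +-cong (*-congˡ (g≈g′ (suc n) ℕ.≤-refl)) (⊛-local n (f ∘ suc) (λ k k≤n → g≈g′ k (ℕ.m≤n⇒m≤1+n k≤n)))

  zero-⊛ : ∀ f g → (∀ k → f k ≈ 0#) → ∀ n → (f ⊛ g) n ≈ 0#
  zero-⊛ f g f≈0 zero    = trans (*-congʳ (f≈0 0)) (zeroˡ _)
  zero-⊛ f g f≈0 (suc n) = trans (+-cong (trans (*-congʳ (f≈0 0)) (zeroˡ _)) (zero-⊛ (f ∘ suc) g (f≈0 ∘ suc) n)) (+-identityˡ 0#)

  scalar-⊛ : ∀ a f g n → ((λ k → a * f k) ⊛ g) n ≈ a * (f ⊛ g) n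
  scalar-⊛ a f g zero    = *-assoc _ _ _
  scalar-⊛ a f g (suc n) = trans (+-cong (*-assoc _ _ _) (scalar-⊛ a (f ∘ suc) g n)) (sym (distribˡ _ _ _))

  ⊛-distribʳ : ∀ f f′ g → (f ⊕ f′) ⊛ g ≋ f ⊛ g ⊕ f′ ⊛ g
  ⊛-distribʳ f f′ g zero    = distribʳ _ _ _
  ⊛-distribʳ f f′ g (suc n) = begin
    (f 0 + f′ 0) * g (suc n) + ((f ∘ suc ⊕ f′ ∘ suc) ⊛ g) n
      ≈⟨ +-cong (distribʳ _ _ _) (⊛-distribʳ (f ∘ suc) (f′ ∘ suc) g n) ⟩
    (f 0 * g (suc n) + f′ 0 * g (suc n)) + (((f ∘ suc) ⊛ g) n + ((f′ ∘ suc) ⊛ g) n)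
      ≈⟨ solve 4 (λ a b c d → (a :+ b) :+ (c :+ d) := (a :+ c) :+ (b :+ d)) refl _ _ _ _ ⟩
    (f 0 * g (suc n) + ((f ∘ suc) ⊛ g) n) + (f′ 0 * g (suc n) + ((f′ ∘ suc) ⊛ g) n) ∎

  ⊛-last : ∀ f g n → (f ⊛ g) (suc n) ≈ (f ⊛ (g ∘ suc)) n + f (suc n) * g 0
  ⊛-last f g zero    = refl
  ⊛-last f g (suc n) = trans (+-congˡ (⊛-last (f ∘ suc) g n)) (sym (+-assoc _ _ _))

  ⊛-comm : ∀ f g → f ⊛ g ≋ g ⊛ f
  ⊛-comm f g zero    = *-comm _ _
  ⊛-comm f g (suc n) = begin
    f 0 * g (suc n) + ((f ∘ suc) ⊛ g) n   ≈⟨ +-congˡ (⊛-comm (f ∘ suc) g n) ⟩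
    f 0 * g (suc n) + (g ⊛ (f ∘ suc)) n   ≈⟨ trans (+-comm _ _) (+-congˡ (*-comm _ _)) ⟩
    (g ⊛ (f ∘ suc)) n + g (suc n) * f 0   ≈⟨ ⊛-last g f n ⟨
    (g ⊛ f) (suc n)                        ∎

  ⊛-distribˡ : ∀ f g g′ → f ⊛ (g ⊕ g′) ≋ f ⊛ g ⊕ f ⊛ g′
  ⊛-distribˡ f g g′ n = trans (⊛-comm f (g ⊕ g′) n) (trans (⊛-distribʳ g g′ f n) (+-cong (⊛-comm g f n) (⊛-comm g′ f n)))

  ⊛-assoc : ∀ f g h → (f ⊛ g) ⊛ h ≋ f ⊛ (g ⊛ h)
  ⊛-assoc f g h zero    = *-assoc _ _ _
  ⊛-assoc f g h (suc n) = begin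
    (f 0 * g 0) * h (suc n) + (((f ⊛ g) ∘ suc) ⊛ h) n
      ≈⟨ +-congˡ (⊛-distribʳ (λ k → f 0 * g (suc k)) ((f ∘ suc) ⊛ g) h n) ⟩
    (f 0 * g 0) * h (suc n) + (((λ k → f 0 * g (suc k)) ⊛ h) n + (((f ∘ suc) ⊛ g) ⊛ h) n)
      ≈⟨ +-congˡ (+-cong (scalar-⊛ (f 0) (g ∘ suc) h n) (⊛-assoc (f ∘ suc) g h n)) ⟩
    (f 0 * g 0) * h (suc n) + (f 0 * ((g ∘ suc) ⊛ h) n + ((f ∘ suc) ⊛ (g ⊛ h)) n)
      ≈⟨ solve 5 (λ a b c d e → (a :* b) :* c :+ (a :* d :+ e) := a :* (b :* c :+ d) :+ e)
               refl (f 0) (g 0) (h (suc n)) (((g ∘ suc) ⊛ h) n) (((f ∘ suc) ⊛ (g ⊛ h)) n) ⟩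
    f 0 * (g 0 * h (suc n) + ((g ∘ suc) ⊛ h) n) + ((f ∘ suc) ⊛ (g ⊛ h)) n ∎

  const-⊛ : ∀ a f → const a ⊛ f ≋ (λ n → a * f n)
  const-⊛ a f zero    = refl
  const-⊛ a f (suc n) = trans (+-congˡ (zero-⊛ (const a ∘ suc) f (λ _ → refl) n)) (+-identityʳ _)

  const-identityˡ : ∀ f → const 1# ⊛ f ≋ f
  const-identityˡ f n = trans (const-⊛ 1# f n) (*-identityˡ _)

  seriesRing : CommutativeRing c ℓ
  seriesRing = record
    { Carrier = Series ; _≈_ = _≋_ ; _+_ = _⊕_ ; _*_ = _⊛_ ; -_ = ⊖_ ; 0# = λ _ → 0# ; 1# = const 1#
    ; isCommutativeRing = record
      { isRing = record
        { +-isAbelianGroup = record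
          { isGroup = record
            { isMonoid = record
              { isSemigroup = record
                { isMagma = record
                  { isEquivalence = record { refl = λ _ → refl ; sym = λ f≋g n → sym (f≋g n) ; trans = λ f≋g g≋h n → trans (f≋g n) (g≋h n) }
                  ; ∙-cong = λ f≋f′ g≋g′ n → +-cong (f≋f′ n) (g≋g′ n) }
                ; assoc = λ f g h n → +-assoc (f n) (g n) (h n) }
              ; identity = (λ f n → +-identityˡ (f n)) , (λ f n → +-identityʳ (f n)) }
            ; inverse = (λ f n → -‿inverseˡ (f n)) , (λ f n → -‿inverseʳ (f n))
            ; ⁻¹-cong = λ f≋g n → -‿cong (f≋g n) }
          ; comm = λ f g n → +-comm (f n) (g n) }
        ; *-cong = ⊛-cong
        ; *-assoc = ⊛-assoc
        ; *-identity = const-identityˡ , (λ f n → trans (⊛-comm f (const 1#) n) (const-identityˡ f n))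
        ; distrib = ⊛-distribˡ , (λ h f g → ⊛-distribʳ f g h) }
      ; *-comm = ⊛-comm } }

  shift : Series → Series
  shift u zero    = 0#
  shift u (suc n) = u n

  X-⊛ : ∀ u → X ⊛ u ≋ shift u
  X-⊛ u zero    = zeroˡ _
  X-⊛ u (suc n) = begin
    0# * u (suc n) + ((X ∘ suc) ⊛ u) n  ≈⟨ +-cong (zeroˡ _) (⊛-cong {g = u} X∘suc≋1 (λ _ → refl) n) ⟩
    0# + (const 1# ⊛ u) n               ≈⟨ trans (+-identityˡ _) (const-identityˡ u n) ⟩
    u n                                 ∎
    where
    X∘suc≋1 : X ∘ suc ≋ const 1#
    X∘suc≋1 zero    = refl
    X∘suc≋1 (suc n) = refl

  const-cong : ∀ {x y} → x ≈ y → const x ≋ const y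
  const-cong x≈y zero    = x≈y
  const-cong x≈y (suc n) = refl

  const-+ : ∀ a b → const (a + b) ≋ const a ⊕ const b
  const-+ a b zero    = refl
  const-+ a b (suc n) = sym (+-identityˡ 0#)

  const-* : ∀ a b → const (a * b) ≋ const a ⊛ const b
  const-* a b n = sym (trans (const-⊛ a (const b) n) (pointwise n))
    where
    pointwise : ∀ n → a * const b n ≈ const (a * b) n
    pointwise zero    = refl
    pointwise (suc n) = zeroʳ a

  dilate : Carrier → Series → Series
  dilate r u n = pow R r n * u n

  dilate-cong : ∀ r {u v} → u ≋ v → dilate r u ≋ dilate r v
  dilate-cong r u≋v n = *-congˡ (u≋v n)

  dilate-⊕ : ∀ r u v → dilate r (u ⊕ v) ≋ dilate r u ⊕ dilate r v
  dilate-⊕ r u v n = distribˡ _ _ _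

  dilate-⊛ : ∀ r f g → dilate r (f ⊛ g) ≋ dilate r f ⊛ dilate r g
  dilate-⊛ r f g zero    = solve 2 (λ x y → con 1 :* (x :* y) := (con 1 :* x) :* (con 1 :* y)) refl (f 0) (g 0)
  dilate-⊛ r f g (suc n) = begin
    (r * rⁿ) * (f 0 * g (suc n) + ((f ∘ suc) ⊛ g) n)
      ≈⟨ solve 5 (λ r p a b c → (r :* p) :* (a :* b :+ c) := (con 1 :* a) :* ((r :* p) :* b) :+ r :* (p :* c))
               refl r rⁿ (f 0) (g (suc n)) (((f ∘ suc) ⊛ g) n) ⟩
    (1# * f 0) * ((r * rⁿ) * g (suc n)) + r * (rⁿ * ((f ∘ suc) ⊛ g) n)
      ≈⟨ +-congˡ (*-congˡ (dilate-⊛ r (f ∘ suc) g n)) ⟩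
    (1# * f 0) * ((r * rⁿ) * g (suc n)) + r * ((dilate r (f ∘ suc)) ⊛ (dilate r g)) n
      ≈⟨ +-congˡ (scalar-⊛ r (dilate r (f ∘ suc)) (dilate r g) n) ⟨
    (1# * f 0) * ((r * rⁿ) * g (suc n)) + ((λ k → r * dilate r (f ∘ suc) k) ⊛ dilate r g) n
      ≈⟨ +-congˡ (⊛-cong {g = dilate r g} (λ k → sym (*-assoc _ _ _)) (λ _ → refl) n) ⟩
    (dilate r f ⊛ dilate r g) (suc n) ∎
    where
    rⁿ = pow R r n

  dilate-const : ∀ r a → dilate r (const a) ≋ const a
  dilate-const r a zero    = *-identityˡ a
  dilate-const r a (suc n) = zeroʳ _

  dilate-X : ∀ r → dilate r X ≋ const r ⊛ X
  dilate-X r n = trans (pointwise n) (sym (const-⊛ r X n))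
    where
    pointwise : ∀ n → dilate r X n ≈ r * X n
    pointwise zero          = trans (zeroʳ _) (sym (zeroʳ _))
    pointwise (suc zero)    = *-congʳ (*-identityʳ r)
    pointwise (suc (suc n)) = trans (zeroʳ _) (sym (zeroʳ _))

  sumTo-cong : ∀ n {φ ψ : ℕ → Carrier} → (∀ k → k ℕ.< n → φ k ≈ ψ k) → sumTo R n φ ≈ sumTo R n ψ
  sumTo-cong zero    φ≈ψ = refl
  sumTo-cong (suc n) φ≈ψ = +-cong (sumTo-cong n (λ k k<n → φ≈ψ k (ℕ.m<n⇒m<1+n k<n))) (φ≈ψ n ℕ.≤-refl)

  ⊛≈sumTo : ∀ f g n → (f ⊛ g) n ≈ sumTo R (suc n) (λ k → f k * g (n ∸ k))
  ⊛≈sumTo f g zero    = sym (+-identityˡ _)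
  ⊛≈sumTo f g (suc n) = begin
    (f ⊛ g) (suc n)                                           ≈⟨ ⊛-last f g n ⟩
    (f ⊛ (g ∘ suc)) n + f (suc n) * g 0                       ≈⟨ +-congʳ (⊛≈sumTo f (g ∘ suc) n) ⟩
    sumTo R (suc n) (λ k → f k * g (suc (n ∸ k))) + f (suc n) * g 0
      ≈⟨ +-cong (sumTo-cong (suc n) (λ k k<1+n → *-congˡ (reflexive (cong g (≡.sym (ℕ.+-∸-assoc 1 (ℕ.s≤s⁻¹ k<1+n)))))))
                (*-congˡ (reflexive (cong g (≡.sym (ℕ.n∸n≡0 n))))) ⟩
    sumTo R (suc (suc n)) (λ k → f k * g (suc n ∸ k))         ∎

  module LinearEquation (b w : Series) where

    -- approximation n k is the k-th coefficient as known at stage n; it is final once k ≤ n.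
    approximation : ℕ → Series
    approximation zero    k = b 0
    approximation (suc n) k with k ℕ.≤? n
    ... | yes _ = approximation n k
    ... | no _  = b (suc n) + (w ⊛ approximation n) n

    solution : Series
    solution n = approximation n n

    approximation-stable : Stable approximation
    approximation-stable n k k≤n with k ℕ.≤? n
    ... | yes _   = ≡.refl
    ... | no k≰n  = ⊥-elim (k≰n k≤n)

    approximation-suc-diagonal : ∀ n → approximation (suc n) (suc n) ≡ b (suc n) + (w ⊛ approximation n) n
    approximation-suc-diagonal n with suc n ℕ.≤? n
    ... | yes 1+n≤n = ⊥-elim (ℕ.1+n≰n 1+n≤n)
    ... | no _      = ≡.refl

    solution-eq : solution ≋ b ⊕ X ⊛ (w ⊛ solution)
    solution-eq zero    = sym (trans (+-congˡ (X-⊛ (w ⊛ solution) 0)) (+-identityʳ _))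
    solution-eq (suc n) = begin
      approximation (suc n) (suc n)      ≡⟨ approximation-suc-diagonal n ⟩
      b (suc n) + (w ⊛ approximation n) n
        ≈⟨ +-congˡ (⊛-local n w (λ k k≤n → reflexive (stable⇒diagonal approximation-stable n k k≤n))) ⟩
      b (suc n) + (w ⊛ solution) n       ≈⟨ +-congˡ (X-⊛ (w ⊛ solution) (suc n)) ⟨
      (b ⊕ X ⊛ (w ⊛ solution)) (suc n)   ∎

module JacobiContinuedFraction {c ℓ} (R : CommutativeRing c ℓ) (s λ′ : ℕ → CommutativeRing.Carrier R) where

  open CommutativeRing R hiding (zero)
  open PowerSeries R using (Series; _≋_; _⊕_; shift)
  open Determinant R using (Matrix; det-cong; _*ᴹ_; det-*ᴹ-unitriangular; det-lowerTriangular)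
  open import Algebra.Properties.Monoid.Sum *-monoid using () renaming (sum to product; sum-cong-≋ to product-cong)
  open import Algebra.Properties.CommutativeMonoid.Sum +-commutativeMonoid
    using (sum; sum-cong-≋; ∑-distrib-+)
  open import Relation.Binary.Reasoning.Setoid setoid
  open import Algebra.Solver.Ring.NaturalCoefficients.Default commutativeSemiring

  infixl 7 _·_
  _·_ : (ℕ → Carrier) → Series → Series
  (a · f) k = a k * f k

  jacobi : Series → Series
  jacobi f = shift f ⊕ s · f ⊕ λ′ · (f ∘ suc)

  record StieltjesTable : Set (c ⊔ ℓ) where
    field
      L       : ℕ → Series
      L-0-0   : L 0 0 ≈ 1#
      L-0-suc : ∀ k → L 0 (suc k) ≈ 0#
      L-suc   : ∀ n → L (suc n) ≋ jacobi (L n)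

  μ : ℕ → Carrier
  μ zero    = 1#
  μ (suc k) = μ k * λ′ k

  ⟨_,_⟩ : Series → Series → ℕ → Carrier
  ⟨ f , g ⟩ M = sum {M} (λ k → f (toℕ k) * g (toℕ k) * μ (toℕ k))

  VanishesFrom : ℕ → Series → Set ℓ
  VanishesFrom M f = ∀ k → M ℕ.≤ k → f k ≈ 0#

  ⟨⟩-cong : ∀ M {f f′ g g′} → f ≋ f′ → g ≋ g′ → ⟨ f , g ⟩ M ≈ ⟨ f′ , g′ ⟩ M
  ⟨⟩-cong M f≋f′ g≋g′ = sum-cong-≋ {M} (λ k → *-congʳ (*-cong (f≋f′ (toℕ k)) (g≋g′ (toℕ k))))

  ⟨⟩-comm : ∀ M f g → ⟨ f , g ⟩ M ≈ ⟨ g , f ⟩ M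
  ⟨⟩-comm M f g = sum-cong-≋ {M} (λ k → *-congʳ (*-comm (f (toℕ k)) (g (toℕ k))))

  ⟨⟩-⊕ˡ : ∀ M f f′ g → ⟨ f ⊕ f′ , g ⟩ M ≈ ⟨ f , g ⟩ M + ⟨ f′ , g ⟩ M
  ⟨⟩-⊕ˡ M f f′ g = begin
    ⟨ f ⊕ f′ , g ⟩ M                                   ≈⟨ sum-cong-≋ {M} {y = λ k → φ k + φ′ k} (λ k → trans (*-congʳ (distribʳ _ _ _)) (distribʳ _ _ _)) ⟩
    sum {M} (λ k → φ k + φ′ k)                        ≈⟨ ∑-distrib-+ φ φ′ ⟩
    ⟨ f , g ⟩ M + ⟨ f′ , g ⟩ M                         ∎
    where
    φ φ′ : Fin M → Carrier
    φ k = f (toℕ k) * g (toℕ k) * μ (toℕ k)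
    φ′ k = f′ (toℕ k) * g (toℕ k) * μ (toℕ k)

  ⟨⟩-· : ∀ M a f g → ⟨ a · f , g ⟩ M ≈ ⟨ f , a · g ⟩ M
  ⟨⟩-· M a f g = sum-cong-≋ {M} (λ k → *-congʳ (solve 3 (λ a f g → (a :* f) :* g := f :* (a :* g)) refl (a (toℕ k)) (f (toℕ k)) (g (toℕ k))))

  ⟨shift⟩ : ∀ M f {g} → VanishesFrom M g → ⟨ shift f , g ⟩ M ≈ ⟨ f , λ′ · (g ∘ suc) ⟩ M
  ⟨shift⟩ zero    f g-vanishes = refl
  ⟨shift⟩ (suc N) f {g} g-vanishes = begin
    0# * g 0 * 1# + sum {N} (λ k → f (toℕ k) * g (suc (toℕ k)) * (μ (toℕ k) * λ′ (toℕ k)))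
      ≈⟨ +-cong (trans (*-congʳ (zeroˡ _)) (zeroˡ _)) (sum-cong-≋ {N} (λ k → solve 4 (λ f g m l → f :* g :* (m :* l) := f :* (l :* g) :* m)
                                                                         refl (f (toℕ k)) (g (suc (toℕ k))) (μ (toℕ k)) (λ′ (toℕ k)))) ⟩
    0# + sum {N} (φ ∘ toℕ)              ≈⟨ +-identityˡ _ ⟩
    sum {N} (φ ∘ toℕ)                   ≈⟨ +-identityʳ _ ⟨
    sum {N} (φ ∘ toℕ) + 0#              ≈⟨ +-congˡ (trans (*-congʳ (trans (*-congˡ (trans (*-congˡ (g-vanishes (suc N) ℕ.≤-refl)) (zeroʳ _))) (zeroʳ _))) (zeroˡ _)) ⟨
    sum {N} (φ ∘ toℕ) + φ N             ≈⟨ sum-toℕ-last +-monoid N φ ⟨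
    ⟨ f , λ′ · (g ∘ suc) ⟩ (suc N)      ∎
    where
    φ : ℕ → Carrier
    φ k = f k * (λ′ k * g (suc k)) * μ k

  jacobi-selfAdjoint : ∀ M {f g} → VanishesFrom M f → VanishesFrom M g → ⟨ jacobi f , g ⟩ M ≈ ⟨ f , jacobi g ⟩ M
  jacobi-selfAdjoint M {f} {g} f-vanishes g-vanishes = begin
    ⟨ shift f ⊕ s · f ⊕ λ′ · (f ∘ suc) , g ⟩ M
      ≈⟨ expand f g ⟩
    ⟨ shift f , g ⟩ M + ⟨ s · f , g ⟩ M + ⟨ λ′ · (f ∘ suc) , g ⟩ M
      ≈⟨ +-cong (+-cong (⟨shift⟩ M f g-vanishes) (⟨⟩-· M s f g)) (⟨⟩-comm M (λ′ · (f ∘ suc)) g) ⟩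
    ⟨ f , λ′ · (g ∘ suc) ⟩ M + ⟨ f , s · g ⟩ M + ⟨ g , λ′ · (f ∘ suc) ⟩ M
      ≈⟨ +-congˡ (trans (sym (⟨shift⟩ M g f-vanishes)) (⟨⟩-comm M (shift g) f)) ⟩
    ⟨ f , λ′ · (g ∘ suc) ⟩ M + ⟨ f , s · g ⟩ M + ⟨ f , shift g ⟩ M
      ≈⟨ +-cong (+-cong (⟨⟩-comm M f (λ′ · (g ∘ suc))) (⟨⟩-comm M f (s · g))) (⟨⟩-comm M f (shift g)) ⟩
    ⟨ λ′ · (g ∘ suc) , f ⟩ M + ⟨ s · g , f ⟩ M + ⟨ shift g , f ⟩ M
      ≈⟨ solve 3 (λ x y z → x :+ y :+ z := z :+ y :+ x) refl (⟨ λ′ · (g ∘ suc) , f ⟩ M) (⟨ s · g , f ⟩ M) (⟨ shift g , f ⟩ M) ⟩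
    ⟨ shift g , f ⟩ M + ⟨ s · g , f ⟩ M + ⟨ λ′ · (g ∘ suc) , f ⟩ M
      ≈⟨ expand g f ⟨
    ⟨ jacobi g , f ⟩ M                  ≈⟨ ⟨⟩-comm M (jacobi g) f ⟩
    ⟨ f , jacobi g ⟩ M                  ∎
    where
    expand : ∀ u v → ⟨ jacobi u , v ⟩ M ≈ ⟨ shift u , v ⟩ M + ⟨ s · u , v ⟩ M + ⟨ λ′ · (u ∘ suc) , v ⟩ M
    expand u v = trans (⟨⟩-⊕ˡ M (shift u ⊕ s · u) (λ′ · (u ∘ suc)) v) (+-congʳ (⟨⟩-⊕ˡ M (shift u) (s · u) v))

  ⟨⟩-truncate : ∀ d M {f} g → VanishesFrom M f → ⟨ f , g ⟩ (d ℕ.+ M) ≈ ⟨ f , g ⟩ M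
  ⟨⟩-truncate zero    M g f-vanishes = refl
  ⟨⟩-truncate (suc d) M {f} g f-vanishes = begin
    ⟨ f , g ⟩ (suc (d ℕ.+ M))                             ≈⟨ sum-toℕ-last +-monoid (d ℕ.+ M) (λ k → f k * g k * μ k) ⟩
    ⟨ f , g ⟩ (d ℕ.+ M) + f (d ℕ.+ M) * g (d ℕ.+ M) * μ (d ℕ.+ M)
      ≈⟨ +-cong (⟨⟩-truncate d M g f-vanishes) (trans (*-congʳ (trans (*-congʳ (f-vanishes _ (ℕ.m≤n+m M d))) (zeroˡ _))) (zeroˡ _)) ⟩
    ⟨ f , g ⟩ M + 0#                                      ≈⟨ +-identityʳ _ ⟩
    ⟨ f , g ⟩ M                                           ∎

  module _ (T : StieltjesTable) where

    open StieltjesTable T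

    L-upper : ∀ n k → n ℕ.< k → L n k ≈ 0#
    L-upper zero    (suc k) _         = L-0-suc k
    L-upper (suc n) (suc k) (s≤s n<k) = begin
      L (suc n) (suc k)                                          ≈⟨ L-suc n (suc k) ⟩
      L n k + s (suc k) * L n (suc k) + λ′ (suc k) * L n (suc (suc k))
        ≈⟨ +-cong (+-cong (L-upper n k n<k) (*-congˡ (L-upper n (suc k) (ℕ.m<n⇒m<1+n n<k))))
                  (*-congˡ (L-upper n (suc (suc k)) (ℕ.m<n⇒m<1+n (ℕ.m<n⇒m<1+n n<k)))) ⟩
      0# + s (suc k) * 0# + λ′ (suc k) * 0#                     ≈⟨ solve 2 (λ x y → con 0 :+ x :* con 0 :+ y :* con 0 := con 0) refl (s (suc k)) (λ′ (suc k)) ⟩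
      0#                                                         ∎

    L-diagonal : ∀ n → L n n ≈ 1#
    L-diagonal zero    = L-0-0
    L-diagonal (suc n) = begin
      L (suc n) (suc n)                                          ≈⟨ L-suc n (suc n) ⟩
      L n n + s (suc n) * L n (suc n) + λ′ (suc n) * L n (suc (suc n))
        ≈⟨ +-cong (+-cong (L-diagonal n) (*-congˡ (L-upper n (suc n) (ℕ.n<1+n n))))
                  (*-congˡ (L-upper n (suc (suc n)) (ℕ.m<n⇒m<1+n (ℕ.n<1+n n)))) ⟩
      1# + s (suc n) * 0# + λ′ (suc n) * 0#                     ≈⟨ solve 2 (λ x y → con 1 :+ x :* con 0 :+ y :* con 0 := con 1) refl (s (suc n)) (λ′ (suc n)) ⟩
      1#                                                         ∎

    L-vanishesFrom : ∀ {M} n → n ℕ.< M → VanishesFrom M (L n)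
    L-vanishesFrom n n<M k M≤k = L-upper n k (ℕ.<-≤-trans n<M M≤k)

    moment : ∀ M i j → i ℕ.+ j ℕ.< M → ⟨ L i , L j ⟩ M ≈ L (i ℕ.+ j) 0
    moment (suc M) zero j _ = begin
      L 0 0 * L j 0 * 1# + sum {M} (λ k → L 0 (suc (toℕ k)) * L j (suc (toℕ k)) * μ (suc (toℕ k)))
        ≈⟨ +-cong (*-congʳ (*-congʳ L-0-0)) (sum-zero +-monoid {M} (λ k → L 0 (suc (toℕ k)) * L j (suc (toℕ k)) * μ (suc (toℕ k))) (λ k → trans (*-congʳ (trans (*-congʳ (L-0-suc (toℕ k))) (zeroˡ _))) (zeroˡ _))) ⟩
      1# * L j 0 * 1# + 0#                                       ≈⟨ solve 1 (λ x → con 1 :* x :* con 1 :+ con 0 := x) refl (L j 0) ⟩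
      L j 0                                                      ∎
    moment M (suc i) j 1+i+j<M = begin
      ⟨ L (suc i) , L j ⟩ M        ≈⟨ ⟨⟩-cong M (L-suc i) (λ k → refl {L j k}) ⟩
      ⟨ jacobi (L i) , L j ⟩ M     ≈⟨ jacobi-selfAdjoint M (L-vanishesFrom i i<M) (L-vanishesFrom j j<M) ⟩
      ⟨ L i , jacobi (L j) ⟩ M     ≈⟨ ⟨⟩-cong M (λ k → refl {L i k}) (λ k → sym (L-suc j k)) ⟩
      ⟨ L i , L (suc j) ⟩ M        ≈⟨ moment M i (suc j) (≡.subst (ℕ._< M) (≡.sym (ℕ.+-suc i j)) 1+i+j<M) ⟩
      L (i ℕ.+ suc j) 0            ≡⟨ cong (λ m → L m 0) (ℕ.+-suc i j) ⟩
      L (suc i ℕ.+ j) 0            ∎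
      where
      i<M : i ℕ.< M
      i<M = ℕ.<-trans (ℕ.m≤m+n (suc i) j) 1+i+j<M
      j<M : j ℕ.< M
      j<M = ℕ.<-trans (s≤s (ℕ.m≤n+m j i)) 1+i+j<M

    det-hankel : ∀ n → det R (suc n) (λ i j → L (toℕ i ℕ.+ toℕ j) 0) ≈ product {suc n} (λ k → μ (toℕ k))
    det-hankel n = begin
      det R (suc n) (λ i j → L (toℕ i ℕ.+ toℕ j) 0)  ≈⟨ det-cong hankel≈LDLᵀ ⟩
      det R (suc n) (LD *ᴹ Lᵀ)                        ≈⟨ det-*ᴹ-unitriangular LD Lᵀ (λ k j j<k → L-upper (toℕ j) (toℕ k) j<k) (λ j → L-diagonal (toℕ j)) ⟩
      det R (suc n) LD                                ≈⟨ det-lowerTriangular LD (λ i k i<k → trans (*-congʳ (L-upper (toℕ i) (toℕ k) i<k)) (zeroˡ _)) ⟩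
      product {suc n} (λ k → LD k k)                  ≈⟨ product-cong {suc n} {λ k → LD k k} (λ k → trans (*-congʳ (L-diagonal (toℕ k))) (*-identityˡ _)) ⟩
      product {suc n} (λ k → μ (toℕ k))               ∎
      where
      LD Lᵀ : Matrix (suc n)
      LD i k = L (toℕ i) (toℕ k) * μ (toℕ k)
      Lᵀ k j = L (toℕ j) (toℕ k)
      hankel≈LDLᵀ : ∀ i j → L (toℕ i ℕ.+ toℕ j) 0 ≈ (LD *ᴹ Lᵀ) i j
      hankel≈LDLᵀ i j = begin
        L (toℕ i ℕ.+ toℕ j) 0                     ≈⟨ moment (n ℕ.+ suc n) (toℕ i) (toℕ j) (ℕ.+-mono-≤-< (ℕ.s≤s⁻¹ (toℕ<n i)) (toℕ<n j)) ⟨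
        ⟨ L (toℕ i) , L (toℕ j) ⟩ (n ℕ.+ suc n)   ≈⟨ ⟨⟩-truncate n (suc n) (L (toℕ j)) (L-vanishesFrom (toℕ i) (toℕ<n i)) ⟩
        ⟨ L (toℕ i) , L (toℕ j) ⟩ (suc n)         ≈⟨ sum-cong-≋ {suc n} {x = λ k → L (toℕ i) (toℕ k) * L (toℕ j) (toℕ k) * μ (toℕ k)}
                                                      (λ k → solve 3 (λ x y m → x :* y :* m := x :* m :* y) refl (L (toℕ i) (toℕ k)) (L (toℕ j) (toℕ k)) (μ (toℕ k))) ⟩
        (LD *ᴹ Lᵀ) i j                            ∎

module CstarSeries {c ℓ} (R : CommutativeRing c ℓ) (a b q : CommutativeRing.Carrier R) where

  open CommutativeRing R hiding (zero)
  open PowerSeries R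
  open import Relation.Binary.Reasoning.Setoid setoid
  open import Algebra.Solver.Ring.NaturalCoefficients.Default commutativeSemiring

  C : Series
  C = Cstar R a b q

  hist-stable : Stable (hist R a b q)
  hist-stable n k k≤n with k ℕ.≤? n
  ... | yes _  = ≡.refl
  ... | no k≰n = ⊥-elim (k≰n k≤n)

  hist-suc-diagonal : ∀ n → hist R a b q (suc n) (suc n) ≡ step R a b q n (hist R a b q n)
  hist-suc-diagonal n with suc n ℕ.≤? n
  ... | yes 1+n≤n = ⊥-elim (ℕ.1+n≰n 1+n≤n)
  ... | no _      = ≡.refl

  C-suc : ∀ n → C (suc n) ≈ a * C n + b * sumTo R n (λ k → pow R q k * C k * C (n ∸ k))
  C-suc n = begin
    hist R a b q (suc n) (suc n)                                          ≡⟨ hist-suc-diagonal n ⟩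
    a * H n + b * sumTo R n (λ k → pow R q k * H k * H (n ∸ k))
      ≈⟨ +-cong (*-congˡ (H≈C ℕ.≤-refl))
                (*-congˡ (sumTo-cong n (λ k k<n → *-cong (*-congˡ (H≈C (ℕ.<⇒≤ k<n))) (H≈C (ℕ.m∸n≤m n k))))) ⟩
    a * C n + b * sumTo R n (λ k → pow R q k * C k * C (n ∸ k))           ∎
    where
    H : ℕ → Carrier
    H = hist R a b q n
    H≈C : ∀ {k} → k ℕ.≤ n → H k ≈ C k
    H≈C {k} k≤n = reflexive (stable⇒diagonal hist-stable n k k≤n)

  U : Series
  U = shift (C ∘ suc)

  C≋1+U : C ≋ const 1# ⊕ U
  C≋1+U zero    = sym (+-identityʳ _)
  C≋1+U (suc n) = sym (+-identityˡ _)

  U-eq : U ≋ X ⊛ (const a ⊛ C ⊕ const b ⊛ (dilate q C ⊛ U))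
  U-eq zero    = sym (X-⊛ (const a ⊛ C ⊕ const b ⊛ (dilate q C ⊛ U)) 0)
  U-eq (suc n) = begin
    C (suc n)                                                    ≈⟨ C-suc n ⟩
    a * C n + b * sumTo R n (λ k → pow R q k * C k * C (n ∸ k))  ≈⟨ +-cong (sym (const-⊛ a C n)) (*-congˡ (sym convolution)) ⟩
    (const a ⊛ C) n + b * (dilate q C ⊛ U) n                     ≈⟨ +-congˡ (sym (const-⊛ b (dilate q C ⊛ U) n)) ⟩
    (const a ⊛ C ⊕ const b ⊛ (dilate q C ⊛ U)) n                 ≈⟨ X-⊛ (const a ⊛ C ⊕ const b ⊛ (dilate q C ⊛ U)) (suc n) ⟨
    (X ⊛ (const a ⊛ C ⊕ const b ⊛ (dilate q C ⊛ U))) (suc n)     ∎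
    where
    U≈C : ∀ m → 0 ℕ.< m → U m ≈ C m
    U≈C (suc m) _ = refl
    convolution : (dilate q C ⊛ U) n ≈ sumTo R n (λ k → pow R q k * C k * C (n ∸ k))
    convolution = begin
      (dilate q C ⊛ U) n                                         ≈⟨ ⊛≈sumTo (dilate q C) U n ⟩
      sumTo R n (λ k → dilate q C k * U (n ∸ k)) + dilate q C n * U (n ∸ n)
        ≈⟨ +-cong (sumTo-cong n (λ k k<n → *-congˡ (U≈C (n ∸ k) (ℕ.m<n⇒0<n∸m k<n))))
                  (trans (*-congˡ (reflexive (cong U (ℕ.n∸n≡0 n)))) (zeroʳ _)) ⟩
      sumTo R n (λ k → pow R q k * C k * C (n ∸ k)) + 0#         ≈⟨ +-identityʳ _ ⟩
      sumTo R n (λ k → pow R q k * C k * C (n ∸ k))              ∎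

  s : ℕ → Carrier
  s zero    = a
  s (suc k) = (a * q + b) * pow R q k

  λ′ : ℕ → Carrier
  λ′ k = a * b * (pow R q k * pow R q k)

  λ′-zero : λ′ 0 ≈ a * b
  λ′-zero = solve 2 (λ a b → a :* b :* (con 1 :* con 1) := a :* b) refl a b

  λ′-suc : ∀ k → a * b * q * q * pow R q k * pow R q k ≈ λ′ (suc k)
  λ′-suc k = solve 4 (λ a b q r → a :* b :* q :* q :* r :* r := a :* b :* ((q :* r) :* (q :* r))) refl a b q (pow R q k)

module CstarContinuedFraction {c ℓ} (R : CommutativeRing c ℓ) (a b q : CommutativeRing.Carrier R) where

  open CommutativeRing R using (_+_; _*_; 1#)
  open PowerSeries R
  open CstarSeries R a b q
  private module S = CommutativeRing seriesRing
  open import Relation.Binary.Reasoning.Setoid S.setoid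
  open import Algebra.Solver.Ring.NaturalCoefficients.Default S.commutativeSemiring
  open import Algebra.Properties.Ring S.ring using (+-cancelʳ)

  𝟙 A B Q F : Series
  𝟙 = const 1#
  A = const a
  B = const b
  Q = const q
  F = dilate q C

  h : Series
  h = LinearEquation.solution 𝟙 (B ⊛ F)

  h-eq : h ≋ 𝟙 ⊕ X ⊛ ((B ⊛ F) ⊛ h)
  h-eq = LinearEquation.solution-eq 𝟙 (B ⊛ F)

  g : Series
  g = F ⊛ h

  -- Multiplying U-eq by h and using h-eq gives U + XBFUh ≈ XACh + XBFUh.
  U≋XACh : U ≋ X ⊛ A ⊛ C ⊛ h
  U≋XACh = +-cancelʳ Z U (X ⊛ A ⊛ C ⊛ h) (begin
    U ⊕ Z                                   ≈⟨ solve 5 (λ U X B F h → U :+ X :* B :* F :* U :* h := U :* (con 1 :+ X :* ((B :* F) :* h))) S.refl U X B F h ⟩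
    U ⊛ (𝟙 ⊕ X ⊛ ((B ⊛ F) ⊛ h))             ≈⟨ S.*-congˡ h-eq ⟨
    U ⊛ h                                   ≈⟨ S.*-congʳ U-eq ⟩
    X ⊛ (A ⊛ C ⊕ B ⊛ (F ⊛ U)) ⊛ h          ≈⟨ solve 7 (λ X A C B F U h → X :* (A :* C :+ B :* (F :* U)) :* h := X :* A :* C :* h :+ X :* B :* F :* U :* h) S.refl X A C B F U h ⟩
    X ⊛ A ⊛ C ⊛ h ⊕ Z                       ∎)
    where
    Z = X ⊛ B ⊛ F ⊛ U ⊛ h

  C-eq : C ≋ 𝟙 ⊕ X ⊛ (A ⊛ C ⊕ (A ⊛ B) ⊛ (X ⊛ (C ⊛ g)))
  C-eq = begin
    C                                                    ≈⟨ C≋1+U ⟩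
    𝟙 ⊕ U                                                ≈⟨ S.+-congˡ U-eq ⟩
    𝟙 ⊕ X ⊛ (A ⊛ C ⊕ B ⊛ (F ⊛ U))                        ≈⟨ S.+-congˡ (S.*-congˡ (S.+-congˡ (S.*-congˡ (S.*-congˡ U≋XACh)))) ⟩
    𝟙 ⊕ X ⊛ (A ⊛ C ⊕ B ⊛ (F ⊛ (X ⊛ A ⊛ C ⊛ h)))
      ≈⟨ solve 6 (λ X A C B F h → con 1 :+ X :* (A :* C :+ B :* (F :* (X :* A :* C :* h)))
                                := con 1 :+ X :* (A :* C :+ (A :* B) :* (X :* (C :* (F :* h))))) S.refl X A C B F h ⟩
    𝟙 ⊕ X ⊛ (A ⊛ C ⊕ (A ⊛ B) ⊛ (X ⊛ (C ⊛ g)))             ∎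

  K₁ K₂ : Series
  K₁ = const (a * q + b)
  K₂ = const (a * b * q * q)

  Fq hq : Series
  Fq = dilate q F
  hq = dilate q h

  F-eq : F ≋ 𝟙 ⊕ dilate q U
  F-eq = S.trans (dilate-cong q C≋1+U) (S.trans (dilate-⊕ q 𝟙 U) (S.+-congʳ (dilate-const q 1#)))

  dilate-U : dilate q U ≋ (Q ⊛ X) ⊛ A ⊛ F ⊛ hq
  dilate-U = begin
    dilate q U                        ≈⟨ dilate-cong q U≋XACh ⟩
    dilate q (X ⊛ A ⊛ C ⊛ h)          ≈⟨ dilate-⊛ q (X ⊛ A ⊛ C) h ⟩
    dilate q (X ⊛ A ⊛ C) ⊛ hq         ≈⟨ S.*-congʳ (dilate-⊛ q (X ⊛ A) C) ⟩
    dilate q (X ⊛ A) ⊛ F ⊛ hq         ≈⟨ S.*-congʳ (S.*-congʳ (S.trans (dilate-⊛ q X A) (S.*-cong (dilate-X q) (dilate-const q a)))) ⟩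
    (Q ⊛ X) ⊛ A ⊛ F ⊛ hq              ∎

  hq-eq : hq ≋ 𝟙 ⊕ (Q ⊛ X) ⊛ ((B ⊛ Fq) ⊛ hq)
  hq-eq = begin
    hq                                          ≈⟨ dilate-cong q h-eq ⟩
    dilate q (𝟙 ⊕ X ⊛ ((B ⊛ F) ⊛ h))            ≈⟨ dilate-⊕ q 𝟙 (X ⊛ ((B ⊛ F) ⊛ h)) ⟩
    dilate q 𝟙 ⊕ dilate q (X ⊛ ((B ⊛ F) ⊛ h))   ≈⟨ S.+-cong (dilate-const q 1#) (dilate-⊛ q X ((B ⊛ F) ⊛ h)) ⟩
    𝟙 ⊕ dilate q X ⊛ dilate q ((B ⊛ F) ⊛ h)     ≈⟨ S.+-congˡ (S.*-cong (dilate-X q) (dilate-⊛ q (B ⊛ F) h)) ⟩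
    𝟙 ⊕ (Q ⊛ X) ⊛ (dilate q (B ⊛ F) ⊛ hq)       ≈⟨ S.+-congˡ (S.*-congˡ (S.*-congʳ (S.trans (dilate-⊛ q B F) (S.*-congʳ (dilate-const q b))))) ⟩
    𝟙 ⊕ (Q ⊛ X) ⊛ ((B ⊛ Fq) ⊛ hq)               ∎

  g-eq : g ≋ 𝟙 ⊕ X ⊛ (K₁ ⊛ g ⊕ K₂ ⊛ (X ⊛ (g ⊛ dilate q g)))
  g-eq = begin
    F ⊛ h                                        ≈⟨ S.*-congʳ (S.trans F-eq (S.+-congˡ dilate-U)) ⟩
    (𝟙 ⊕ (Q ⊛ X) ⊛ A ⊛ F ⊛ hq) ⊛ h
      ≈⟨ solve 6 (λ Q X A F h hq → (con 1 :+ (Q :* X) :* A :* F :* hq) :* h := h :+ (A :* Q :* X :* F :* h) :* hq) S.refl Q X A F h hq ⟩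
    h ⊕ (A ⊛ Q ⊛ X ⊛ F ⊛ h) ⊛ hq                  ≈⟨ S.+-cong h-eq (S.*-congˡ hq-eq) ⟩
    (𝟙 ⊕ X ⊛ ((B ⊛ F) ⊛ h)) ⊕ (A ⊛ Q ⊛ X ⊛ F ⊛ h) ⊛ (𝟙 ⊕ (Q ⊛ X) ⊛ ((B ⊛ Fq) ⊛ hq))
      ≈⟨ solve 8 (λ X A B Q F h Fq hq →
                    (con 1 :+ X :* ((B :* F) :* h)) :+ (A :* Q :* X :* F :* h) :* (con 1 :+ (Q :* X) :* ((B :* Fq) :* hq))
                 := con 1 :+ X :* ((A :* Q :+ B) :* (F :* h) :+ (A :* B :* Q :* Q) :* (X :* ((F :* h) :* (Fq :* hq)))))
                 S.refl X A B Q F h Fq hq ⟩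
    𝟙 ⊕ X ⊛ ((A ⊛ Q ⊕ B) ⊛ g ⊕ (A ⊛ B ⊛ Q ⊛ Q) ⊛ (X ⊛ (g ⊛ (Fq ⊛ hq))))
      ≈⟨ S.+-congˡ (S.*-congˡ (S.+-cong (S.*-congʳ K₁-eq) (S.*-cong K₂-eq (S.*-congˡ (S.*-congˡ (dilate-⊛ q F h)))))) ⟨
    𝟙 ⊕ X ⊛ (K₁ ⊛ g ⊕ K₂ ⊛ (X ⊛ (g ⊛ dilate q g))) ∎
    where
    K₁-eq : K₁ ≋ A ⊛ Q ⊕ B
    K₁-eq = S.trans (const-+ (a * q) b) (S.+-congʳ (const-* a q))
    K₂-eq : K₂ ≋ A ⊛ B ⊛ Q ⊛ Q
    K₂-eq = S.trans (const-* (a * b * q) q) (S.*-congʳ (S.trans (const-* (a * b) q) (S.*-congʳ (const-* a b))))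

  J : ℕ → Series
  J zero    = g
  J (suc k) = dilate q (J k)

  scaledX : ℕ → Series
  scaledX k = const (pow R q k) ⊛ X

  dilate-scaledX : ∀ k → dilate q (scaledX k) ≋ scaledX (suc k)
  dilate-scaledX k = begin
    dilate q (const r ⊛ X)             ≈⟨ S.trans (dilate-⊛ q (const r) X) (S.*-cong (dilate-const q r) (dilate-X q)) ⟩
    const r ⊛ (Q ⊛ X)                  ≈⟨ solve 3 (λ r Q X → r :* (Q :* X) := (Q :* r) :* X) S.refl (const r) Q X ⟩
    (Q ⊛ const r) ⊛ X                  ≈⟨ S.*-congʳ (const-* q r) ⟨
    const (q * r) ⊛ X                  ∎
    where
    r = pow R q k

  J-eq : ∀ k → J k ≋ 𝟙 ⊕ scaledX k ⊛ (K₁ ⊛ J k ⊕ K₂ ⊛ (scaledX k ⊛ (J k ⊛ J (suc k))))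
  J-eq zero = S.trans g-eq
    (solve 5 (λ X K₁ g K₂ G → con 1 :+ X :* (K₁ :* g :+ K₂ :* (X :* (g :* G)))
                           := con 1 :+ (con 1 :* X) :* (K₁ :* g :+ K₂ :* ((con 1 :* X) :* (g :* G))))
             S.refl X K₁ g K₂ (dilate q g))
  J-eq (suc k) = begin
    dilate q (J k)                                          ≈⟨ dilate-cong q (J-eq k) ⟩
    dilate q (𝟙 ⊕ Xₖ ⊛ (K₁ ⊛ J k ⊕ K₂ ⊛ (Xₖ ⊛ (J k ⊛ J (suc k)))))
      ≈⟨ S.trans (dilate-⊕ q 𝟙 _) (S.+-cong (dilate-const q 1#) (dilate-⊛ q Xₖ _)) ⟩
    𝟙 ⊕ dilate q Xₖ ⊛ dilate q (K₁ ⊛ J k ⊕ K₂ ⊛ (Xₖ ⊛ (J k ⊛ J (suc k))))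
      ≈⟨ S.+-congˡ (S.*-cong (dilate-scaledX k) (dilate-⊕ q (K₁ ⊛ J k) _)) ⟩
    𝟙 ⊕ scaledX (suc k) ⊛ (dilate q (K₁ ⊛ J k) ⊕ dilate q (K₂ ⊛ (Xₖ ⊛ (J k ⊛ J (suc k)))))
      ≈⟨ S.+-congˡ (S.*-congˡ (S.+-cong (dilate-⊛-const (a * q + b) (J k)) (dilate-⊛-const (a * b * q * q) _))) ⟩
    𝟙 ⊕ scaledX (suc k) ⊛ (K₁ ⊛ J (suc k) ⊕ K₂ ⊛ dilate q (Xₖ ⊛ (J k ⊛ J (suc k))))
      ≈⟨ S.+-congˡ (S.*-congˡ (S.+-congˡ (S.*-congˡ (S.trans (dilate-⊛ q Xₖ _) (S.*-cong (dilate-scaledX k) (dilate-⊛ q (J k) (J (suc k)))))))) ⟩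
    𝟙 ⊕ scaledX (suc k) ⊛ (K₁ ⊛ J (suc k) ⊕ K₂ ⊛ (scaledX (suc k) ⊛ (J (suc k) ⊛ J (suc (suc k))))) ∎
    where
    Xₖ = scaledX k
    dilate-⊛-const : ∀ x u → dilate q (const x ⊛ u) ≋ const x ⊛ dilate q u
    dilate-⊛-const x u = S.trans (dilate-⊛ q (const x) u) (S.*-congʳ (dilate-const q x))

  P : ℕ → Series
  P zero    = C
  P (suc k) = X ⊛ (P k ⊛ J k)

  P-zero : P 0 ≋ 𝟙 ⊕ X ⊛ (const (s 0) ⊛ P 0 ⊕ const (λ′ 0) ⊛ P 1)
  P-zero = S.trans C-eq (S.+-congˡ (S.*-congˡ (S.+-congˡ (S.*-congʳ (S.sym λ′₀-eq)))))
    where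
    λ′₀-eq : const (λ′ 0) ≋ A ⊛ B
    λ′₀-eq = S.trans (const-cong λ′-zero) (const-* a b)

  P-suc : ∀ k → P (suc k) ≋ X ⊛ (P k ⊕ const (s (suc k)) ⊛ P (suc k) ⊕ const (λ′ (suc k)) ⊛ P (suc (suc k)))
  P-suc k = begin
    X ⊛ (P k ⊛ J k)                                             ≈⟨ S.*-congˡ (S.*-congˡ (J-eq k)) ⟩
    X ⊛ (P k ⊛ (𝟙 ⊕ (r ⊛ X) ⊛ (K₁ ⊛ J k ⊕ K₂ ⊛ ((r ⊛ X) ⊛ (J k ⊛ J (suc k))))))
      ≈⟨ solve 7 (λ X p r K₁ K₂ j j′ → X :* (p :* (con 1 :+ (r :* X) :* (K₁ :* j :+ K₂ :* ((r :* X) :* (j :* j′)))))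
                                     := X :* (p :+ (K₁ :* r) :* (X :* (p :* j)) :+ (K₂ :* r :* r) :* (X :* ((X :* (p :* j)) :* j′))))
               S.refl X (P k) r K₁ K₂ (J k) (J (suc k)) ⟩
    X ⊛ (P k ⊕ (K₁ ⊛ r) ⊛ P (suc k) ⊕ (K₂ ⊛ r ⊛ r) ⊛ P (suc (suc k)))
      ≈⟨ S.*-congˡ (S.+-cong (S.+-congˡ (S.*-congʳ (S.sym (const-* (a * q + b) (pow R q k))))) (S.*-congʳ λ′-eq)) ⟩
    X ⊛ (P k ⊕ const (s (suc k)) ⊛ P (suc k) ⊕ const (λ′ (suc k)) ⊛ P (suc (suc k))) ∎
    where
    r = const (pow R q k)
    λ′-eq : K₂ ⊛ r ⊛ r ≋ const (λ′ (suc k))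
    λ′-eq = S.trans (S.*-congʳ (S.sym (const-* (a * b * q * q) (pow R q k)))) (S.trans (S.sym (const-* _ (pow R q k)))
              (const-cong (λ′-suc k)))


open import Data.Nat.Combinatorics using (_C_; nC1≡n; nCk+nC[k+1]≡[n+1]C[k+1])
open import Data.Nat.DivMod using (m*n/n≡m; +-distrib-/-∣ʳ)
open import Data.Nat.Divisibility using (n∣m*n)

1+n+[n+1]C2≡[n+2]C2 : ∀ n → suc n C 2 ℕ.+ suc n ≡ suc (suc n) C 2
1+n+[n+1]C2≡[n+2]C2 n = ≡.trans (cong (suc n C 2 ℕ.+_) (≡.sym (nC1≡n (suc n))))
  (≡.trans (ℕ.+-comm (suc n C 2) (suc n C 1)) (nCk+nC[k+1]≡[n+1]C[k+1] (suc n) 1))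

qExponent : ℕ → ℕ
qExponent n = n ℕ.* suc n ℕ.* (n ∸ 1) / 3

qExponent-suc : ∀ n → qExponent (suc n) ≡ qExponent n ℕ.+ suc n ℕ.* n
qExponent-suc n = begin
  suc n ℕ.* suc (suc n) ℕ.* n / 3                              ≡⟨ cong (_/ 3) (expand n) ⟩
  (n ℕ.* suc n ℕ.* (n ∸ 1) ℕ.+ suc n ℕ.* n ℕ.* 3) / 3             ≡⟨ +-distrib-/-∣ʳ (n ℕ.* suc n ℕ.* (n ∸ 1)) (n∣m*n (suc n ℕ.* n)) ⟩
  qExponent n ℕ.+ suc n ℕ.* n ℕ.* 3 / 3                          ≡⟨ cong (qExponent n ℕ.+_) (m*n/n≡m (suc n ℕ.* n) 3) ⟩
  qExponent n ℕ.+ suc n ℕ.* n                                  ∎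
  where
  open ≡.≡-Reasoning
  expand : ∀ n → suc n ℕ.* suc (suc n) ℕ.* n ≡ n ℕ.* suc n ℕ.* (n ∸ 1) ℕ.+ suc n ℕ.* n ℕ.* 3
  expand zero    = ≡.refl
  expand (suc m) = polynomial m
    where
    polynomial : ∀ m → suc (suc m) ℕ.* suc (suc (suc m)) ℕ.* suc m ≡ suc m ℕ.* suc (suc m) ℕ.* m ℕ.+ suc (suc m) ℕ.* suc m ℕ.* 3
    polynomial = solve-∀

module CstarHankel {c ℓ} (R : CommutativeRing c ℓ) (a b q : CommutativeRing.Carrier R) where

  open CommutativeRing R hiding (zero)
  open PowerSeries R using (_≋_; _⊕_; _⊛_; X; const; X-⊛; const-⊛)
  open CstarSeries R a b q using (s; λ′)
  open CstarContinuedFraction R a b q using (P; J; P-zero; P-suc)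
  open JacobiContinuedFraction R s λ′ using (StieltjesTable; jacobi; μ)
  open import Algebra.Properties.Semiring.Exp semiring using (_^_; ^-homo-*)
  open import Algebra.Properties.Monoid.Sum *-monoid using () renaming (sum to product)
  open import Algebra.Solver.Ring.NaturalCoefficients.Default commutativeSemiring
  open import Relation.Binary.Reasoning.Setoid setoid

  table : StieltjesTable
  table = record
    { L       = λ n k → P k n
    ; L-0-0   = refl
    ; L-0-suc = λ k → X-⊛ (P k ⊛ J k) 0
    ; L-suc   = L-suc
    }
    where
    L-suc : ∀ n → (λ k → P k (suc n)) ≋ jacobi (λ k → P k n)
    L-suc n zero    = begin
      P 0 (suc n)                                                   ≈⟨ P-zero (suc n) ⟩
      0# + (X ⊛ (const (s 0) ⊛ P 0 ⊕ const (λ′ 0) ⊛ P 1)) (suc n)   ≈⟨ +-congˡ (X-⊛ (const (s 0) ⊛ P 0 ⊕ const (λ′ 0) ⊛ P 1) (suc n)) ⟩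
      0# + ((const (s 0) ⊛ P 0) n + (const (λ′ 0) ⊛ P 1) n)         ≈⟨ +-congˡ (+-cong (const-⊛ (s 0) (P 0) n) (const-⊛ (λ′ 0) (P 1) n)) ⟩
      0# + (s 0 * P 0 n + λ′ 0 * P 1 n)                             ≈⟨ +-assoc 0# _ _ ⟨
      0# + s 0 * P 0 n + λ′ 0 * P 1 n                               ∎
    L-suc n (suc k) = begin
      P (suc k) (suc n)                                             ≈⟨ P-suc k (suc n) ⟩
      (X ⊛ (P k ⊕ const (s (suc k)) ⊛ P (suc k) ⊕ const (λ′ (suc k)) ⊛ P (suc (suc k)))) (suc n)
        ≈⟨ X-⊛ (P k ⊕ const (s (suc k)) ⊛ P (suc k) ⊕ const (λ′ (suc k)) ⊛ P (suc (suc k))) (suc n) ⟩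
      P k n + (const (s (suc k)) ⊛ P (suc k)) n + (const (λ′ (suc k)) ⊛ P (suc (suc k))) n
        ≈⟨ +-cong (+-congˡ (const-⊛ (s (suc k)) (P (suc k)) n)) (const-⊛ (λ′ (suc k)) (P (suc (suc k))) n) ⟩
      P k n + s (suc k) * P (suc k) n + λ′ (suc k) * P (suc (suc k)) n ∎

  pow≡^ : ∀ x n → pow R x n ≡ x ^ n
  pow≡^ x zero    = ≡.refl
  pow≡^ x (suc n) = cong (x *_) (pow≡^ x n)

  μ-closed : ∀ k → μ k ≈ (a * b) ^ k * q ^ (k ℕ.* (k ∸ 1))
  μ-closed zero    = sym (*-identityˡ 1#)
  μ-closed (suc k) = begin
    μ k * (a * b * (pow R q k * pow R q k))
      ≈⟨ *-cong (μ-closed k) (reflexive (cong (λ x → a * b * (x * x)) (pow≡^ q k))) ⟩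
    (a * b) ^ k * q ^ (k ℕ.* (k ∸ 1)) * (a * b * (q ^ k * q ^ k))
      ≈⟨ solve 4 (λ x y z w → x :* y :* (z :* (w :* w)) := z :* x :* (y :* (w :* w))) refl ((a * b) ^ k) (q ^ (k ℕ.* (k ∸ 1))) (a * b) (q ^ k) ⟩
    (a * b) ^ suc k * (q ^ (k ℕ.* (k ∸ 1)) * (q ^ k * q ^ k))
      ≈⟨ *-congˡ (trans (*-congˡ (sym (^-homo-* q k k))) (sym (^-homo-* q (k ℕ.* (k ∸ 1)) (k ℕ.+ k)))) ⟩
    (a * b) ^ suc k * q ^ (k ℕ.* (k ∸ 1) ℕ.+ (k ℕ.+ k))          ≡⟨ cong (λ e → (a * b) ^ suc k * q ^ e) (exponent k) ⟩
    (a * b) ^ suc k * q ^ (suc k ℕ.* k)                      ∎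
    where
    exponent : ∀ k → k ℕ.* (k ∸ 1) ℕ.+ (k ℕ.+ k) ≡ suc k ℕ.* k
    exponent zero    = ≡.refl
    exponent (suc m) = polynomial m
      where
      polynomial : ∀ m → suc m ℕ.* m ℕ.+ (suc m ℕ.+ suc m) ≡ suc (suc m) ℕ.* suc m
      polynomial = solve-∀

  product-μ : ∀ n → product {suc n} (λ k → μ (toℕ k)) ≈ (a * b) ^ (suc n C 2) * q ^ qExponent n
  product-μ zero    = refl
  product-μ (suc n) = begin
    product {suc (suc n)} (μ ∘ toℕ)                               ≈⟨ sum-toℕ-last *-monoid (suc n) μ ⟩
    product {suc n} (μ ∘ toℕ) * μ (suc n)                         ≈⟨ *-cong (product-μ n) (μ-closed (suc n)) ⟩
    (a * b) ^ (suc n C 2) * q ^ qExponent n * ((a * b) ^ suc n * q ^ (suc n ℕ.* n))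
      ≈⟨ solve 4 (λ x y z w → x :* y :* (z :* w) := x :* z :* (y :* w)) refl ((a * b) ^ (suc n C 2)) (q ^ qExponent n) ((a * b) ^ suc n) (q ^ (suc n ℕ.* n)) ⟩
    (a * b) ^ (suc n C 2) * (a * b) ^ suc n * (q ^ qExponent n * q ^ (suc n ℕ.* n))
      ≈⟨ *-cong (sym (^-homo-* (a * b) (suc n C 2) (suc n))) (sym (^-homo-* q (qExponent n) (suc n ℕ.* n))) ⟩
    (a * b) ^ (suc n C 2 ℕ.+ suc n) * q ^ (qExponent n ℕ.+ suc n ℕ.* n)
      ≡⟨ cong₂ (λ e f → (a * b) ^ e * q ^ f) (1+n+[n+1]C2≡[n+2]C2 n) (≡.sym (qExponent-suc n)) ⟩
    (a * b) ^ (suc (suc n) C 2) * q ^ qExponent (suc n)           ∎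

open import Data.Nat using (ℕ; suc; _+_; _∸_; _/_)
open import Data.Nat.Combinatorics using (_C_)
open import Data.Fin using (toℕ)

mainTheorem4 : ∀ {c ℓ} (R : CommutativeRing c ℓ) (a b q : CommutativeRing.Carrier R) (n : ℕ) →
    CommutativeRing._≈_ R
      (det R (suc n) (λ i j → Cstar R a b q (toℕ i + toℕ j)))
      (CommutativeRing._*_ R
        (pow R (CommutativeRing._*_ R a b) (suc n C 2))
        (pow R q ((n Data.Nat.* suc n Data.Nat.* (n ∸ 1)) / 3)))
mainTheorem4 R a b q n = begin
  det R (suc n) (λ i j → Cstar R a b q (toℕ i + toℕ j))  ≈⟨ det-hankel table n ⟩
  product {suc n} (λ k → μ (toℕ k))                       ≈⟨ product-μ n ⟩
  (a * b) ^ (suc n C 2) * q ^ qExponent n                 ≡⟨ cong₂ _*_ (≡.sym (pow≡^ (a * b) (suc n C 2))) (≡.sym (pow≡^ q (qExponent n))) ⟩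
  pow R (a * b) (suc n C 2) * pow R q (qExponent n)       ∎
  where
  open CommutativeRing R using (_*_; semiring; *-monoid; setoid)
  open CstarSeries R a b q using (s; λ′)
  open JacobiContinuedFraction R s λ′ using (μ; det-hankel)
  open CstarHankel R a b q
  open import Algebra.Properties.Semiring.Exp semiring using (_^_)
  open import Algebra.Properties.Monoid.Sum *-monoid using () renaming (sum to product)
  open import Relation.Binary.Reasoning.Setoid setoid
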